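{- Let $(X_n)_{n\in\mathbb N}$ be a sequence of pairwise disjoint non-empty finite sets with unbounded cardinalities, let $0\le\alpha\le\beta<1$, let $d\ge1$ be an integer, let $\mathfrak X_n=\{A\subseteq X_n:\alpha\#X_n\le\#A\le\beta\#X_n\}$ and $\mathfrak X=\bigcup_n\mathfrak X_n$. Define $\mathscr c:[\mathfrak X]^d\to\{0,1\}$ by $\mathscr c(\mathcal A)=0$ if there is $n$ with $\bigcup(\mathcal A\cap\mathfrak X_n)=X_n$, and $\mathscr c(\mathcal A)=1$ otherwise; let $\mathscr c_n$ be its restriction to $[\mathfrak X_n]^d$. Let $\mathcal H_0(\mathscr c)$ (resp. $\mathcal H_0(\mathscr c_n)$) be the $d$-uniform hypergraph on $\mathfrak X$ (resp. $\mathfrak X_n$) whose hyperedges are the $d$-sets of color $0$. Then $\sup_n\chi(\mathcal H_0(\mathscr c_n))\le\chi(\mathcal H_0(\mathscr c))\le\sup_n\chi(\mathcal H_0(\mathscr c_n))\cdot d$ (cardinal arithmetic). In particular, the ideal $\langle\hom(\mathscr c)\rangle$ is non-trivial if and only if $\sup_n\chi(\mathcal H_0(\mathscr c_n))=\infty$.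
   Context: The chromatic number $\chi(\mathcal H)$ of a hypergraph $\mathcal H$ is the least cardinal $\kappa$ such that there is a coloring of the vertices with $\kappa$ colors with no monochromatic hyperedge. A set $\mathcal A\subseteq\mathfrak X$ is $\mathscr c$-homogeneous if $\mathscr c$ is constant on $[\mathcal A]^d$ (sets with fewer than $d$ elements are homogeneous of both colors); $\langle\hom(\mathscr c)\rangle$ is the ideal on the countable set $\mathfrak X$ generated by the finite sets and the $\mathscr c$-homogeneous sets; it is non-trivial if it is not $\mathcal P(\mathfrak X)$. -}

module Defs where

open import Level using (0ℓ)
open import Data.Nat using (ℕ; suc; _≤_)
open import Data.Integer using (+_)
open import Data.Rational using (ℚ; _/_; _*_; _<_; 0ℚ; 1ℚ)
import Data.Rational as Q
open import Data.Fin using (Fin)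
open import Data.Fin.Subset using (Subset; ∣_∣; _∈_)
open import Data.List using (List)
open import Data.List.Relation.Unary.Any using (Any)
open import Data.Product using (Σ; ∃; _×_; _,_; proj₁)
open import Data.Sum using (_⊎_)
open import Data.Unit using (⊤)
open import Relation.Nullary using (¬_)
open import Relation.Binary.PropositionalEquality using (_≡_; _≢_; subst; sym)
open import Function using (_∘_; _⇔_)

record ℝ : Set₁ where
  field
    L U        : ℚ → Set
    L-inhabited : ∃ λ q → L q
    U-inhabited : ∃ λ q → U q
    L-rounded  : ∀ q → L q ⇔ (∃ λ r → q < r × L r)
    U-rounded  : ∀ r → U r ⇔ (∃ λ q → q < r × U q)
    disjoint   : ∀ q → ¬ (L q × U q)
    located    : ∀ q r → q < r → L q ⊎ U r
open ℝ public

ℕ→ℚ : ℕ → ℚ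
ℕ→ℚ n = + n / 1

0≤ʳ : ℝ → Set
0≤ʳ x = ¬ U x 0ℚ

_≤ʳ_ : ℝ → ℝ → Set
x ≤ʳ y = ∀ q → L x q → L y q

_<1 : ℝ → Set
x <1 = U x 1ℚ

_·_≤ℕ_ : ℝ → ℕ → ℕ → Set
x · m ≤ℕ a = ∀ q → L x q → (q * ℕ→ℚ m) Q.≤ ℕ→ℚ a

_≤ℕ_·_ : ℕ → ℝ → ℕ → Set
a ≤ℕ x · m = ∀ q → U x q → ℕ→ℚ a Q.≤ (q * ℕ→ℚ m)

-- A d-uniform hypergraph on a vertex setoid
-- (V , _≈_) is given by a predicate E on d-indexed families of
-- vertices; its hyperedges are the d-sets {𝒜 0, …, 𝒜 (d-1)} for
-- families 𝒜 of pairwise distinct vertices with E 𝒜.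

Distinct : {V : Set} (_≈_ : V → V → Set) {d : ℕ} → (Fin d → V) → Set
Distinct _≈_ 𝒜 = ∀ i j → i ≢ j → ¬ (𝒜 i ≈ 𝒜 j)

Colorable : (V : Set) (_≈_ : V → V → Set) (d : ℕ)
            (E : (Fin d → V) → Set) (m : ℕ) → Set
Colorable V _≈_ d E m =
  Σ (V → Fin m) λ f →
    (∀ x y → x ≈ y → f x ≡ f y) ×
    (∀ (𝒜 : Fin d → V) → Distinct _≈_ 𝒜 → E 𝒜 →
       ¬ (∀ i j → f (𝒜 i) ≡ f (𝒜 j)))

-- The setting.  X n = Fin (k n); the X n are made pairwise disjoint
-- by taking the points of ⋃ X n to be pairs (n , i).

module Setting (k : ℕ → ℕ) (α β : ℝ) (d : ℕ) where

  Point : Set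
  Point = Σ ℕ λ n → Fin (k n)

  InRange : (n : ℕ) → Subset (k n) → Set
  InRange n A = (α · k n ≤ℕ ∣ A ∣) × (∣ A ∣ ≤ℕ β · k n)

  𝔛ₙ : ℕ → Set
  𝔛ₙ n = Σ (Subset (k n)) (InRange n)

  _≈ₙ_ : ∀ {n} → 𝔛ₙ n → 𝔛ₙ n → Set
  x ≈ₙ y = proj₁ x ≡ proj₁ y

  -- 𝔛 = ⋃ 𝔛_n : an element is a subset of some X n; two elements are
  -- equal iff they have the same points (so ∅ is a single element).
  𝔛 : Set
  𝔛 = Σ ℕ 𝔛ₙ

  ι : (n : ℕ) → 𝔛ₙ n → 𝔛
  ι n x = n , x

  _∋_ : 𝔛 → Point → Set
  (n , A , _) ∋ (m , i) = Σ (n ≡ m) λ e → subst (Fin ∘ k) (sym e) i ∈ A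

  _≈_ : 𝔛 → 𝔛 → Set
  x ≈ y = ∀ p → (x ∋ p) ⇔ (y ∋ p)

  Color0 : (Fin d → 𝔛) → Set
  Color0 𝒜 = Σ ℕ λ n → ∀ (i : Fin (k n)) → Σ (Fin d) λ j → 𝒜 j ∋ (n , i)

  Color1 : (Fin d → 𝔛) → Set
  Color1 𝒜 = ¬ Color0 𝒜

  χ≤ : ℕ → Set
  χ≤ m = Colorable 𝔛 _≈_ d Color0 m

  χₙ≤ : ℕ → ℕ → Set
  χₙ≤ n m = Colorable (𝔛ₙ n) _≈ₙ_ d (λ 𝒜 → Color0 (ι n ∘ 𝒜)) m

  supχₙ≤ : ℕ → Set
  supχₙ≤ m = ∀ n → χₙ≤ n m

  Homogeneous : (𝔛 → Set) → Set
  Homogeneous S =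
      (∀ (𝒜 : Fin d → 𝔛) → Distinct _≈_ 𝒜 → (∀ j → S (𝒜 j)) → Color0 𝒜)
    ⊎ (∀ (𝒜 : Fin d → 𝔛) → Distinct _≈_ 𝒜 → (∀ j → S (𝒜 j)) → Color1 𝒜)

  -- membership in ⟨hom(𝒸)⟩, the ideal generated by the finite sets and
  -- the 𝒸-homogeneous sets: S is covered by a finite set and finitely
  -- many homogeneous sets.
  InIdeal : (𝔛 → Set) → Set₁
  InIdeal S =
    Σ (List 𝔛) λ F → Σ ℕ λ r → Σ (Fin r → (𝔛 → Set)) λ B →
      (∀ i → Homogeneous (B i)) ×
      (∀ x → S x → Any (x ≈_) F ⊎ Σ (Fin r) λ i → B i x)

  NonTrivialIdeal : Set₁
  NonTrivialIdeal = ¬ InIdeal (λ _ → ⊤)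

module Submission where

-- Restricting a colouring of ℋ₀(𝒸) to 𝔛ₙ gives the first inequality, and the colour classes of a
-- colouring are 1-homogeneous, so a bounded sup χ(ℋ₀(𝒸ₙ)) makes ⟨hom(𝒸)⟩ trivial.
--
-- For the second inequality, colour A ∈ 𝔛ₙ by its colour c under a colouring of ℋ₀(𝒸ₙ) together
-- with a label in Fin d numbering the sets of colour c. The sets of a monochromatic 0-edge that lie
-- in the level 𝔛ₙ they cover share c and the label. If at least d sets have colour c, these extend
-- to d distinct sets of colour c covering Xₙ, a monochromatic edge of ℋ₀(𝒸ₙ); otherwise the label
-- is injective on colour c, and a single set of size ≤ β·#Xₙ < #Xₙ would cover Xₙ.
-- Membership in 𝔛ₙ is undecidable for real α and β, but locatedness decides it up to one boundary
-- size at each end, so the sets of colour c can still be numbered: the certain sizes first, then the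
-- sets at the upper boundary size, while those at the lower boundary size are numbered down from d − 1.
--
-- Conversely, if finitely many sets and homogeneous sets cover 𝔛, colour a set in 𝔛ₙ by the part of
-- the cover it lies in, numbering the members of 0-homogeneous parts: d sets missing a common point
-- cannot be covering, so by double counting such a part meets 𝔛ₙ in boundedly many sets. As the cover
-- depends on membership proofs, each zone instead gets the first proper colouring found by search.

open import Data.Bool as Bool using (true; false; if_then_else_)
open import Data.Empty using (⊥; ⊥-elim)
open import Data.Fin as Fin
  using (Fin; zero; suc; toℕ; fromℕ<; inject≤; combine; remQuot; splitAt; _↑ˡ_; _↑ʳ_)
import Data.Fin.Properties as Fin
open import Data.Fin.Patterns using (0F; 1F; 2F)
open import Data.Fin.Subset using (Subset; inside; outside; ∣_∣; _∈_; ∁; Nonempty)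
open import Data.Fin.Subset.Properties
  using (_∈?_; nonempty?; anySubset?; ⊆-antisym; ∈⊤; ∣⊤∣≡n; ∣∁p∣≡n∸∣p∣; x∈∁p⇒x∉p)
open import Data.Integer as ℤ using (+_)
import Data.Integer.Properties as ℤ
open import Data.List using (List; []; _∷_; [_]; _++_; length; lookup; filter; cartesianProductWith)
import Data.List.Properties as List
open import Data.List.Membership.Propositional using () renaming (_∈_ to _∈ˡ_)
open import Data.List.Membership.Propositional.Properties
  using (∈-lookup; ∈-++⁺ˡ; ∈-++⁺ʳ; ∈-++⁻; ∈-filter⁺; ∈-filter⁻; ∈-cartesianProductWith⁺)
import Data.List.Membership.DecPropositional as DecMembership
open import Data.List.Relation.Binary.Disjoint.Propositional using (Disjoint)
open import Data.List.Relation.Binary.Subset.Propositional using () renaming (_⊆_ to _⊆ˡ_)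
import Data.List.Relation.Unary.All as All
open import Data.List.Relation.Unary.AllPairs using ([]; _∷_)
open import Data.List.Relation.Unary.Any using (Any; here; there; index)
open import Data.List.Relation.Unary.Any.Properties using (lookup-index)
open import Data.List.Relation.Unary.Unique.Propositional using (Unique)
import Data.List.Relation.Unary.Unique.Propositional.Properties as Unique
import Data.Maybe
open import Data.Maybe using (Maybe; just; nothing)
import Data.Maybe.Properties as Maybe
open import Data.Nat as ℕ using (ℕ; zero; suc; _≤_; _<_; _+_; _*_; _∸_; z≤n; s≤s; NonZero)
import Data.Nat.Properties as ℕ
open import Data.Nat.DivMod using (_mod_; _%_; m<n⇒m%n≡m)
open import Algebra.Properties.CommutativeMonoid.Sum ℕ.+-0-commutativeMonoid
  using (sum-syntax; sum-cong-≗; ∑-distrib-+)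
open import Data.Product using (Σ; ∃; ∃₂; _×_; _,_; proj₁; proj₂)
open import Data.Rational as ℚ using (ℚ; _/_; 1ℚ; ↥_; ↧ₙ_; toℚᵘ; Positive)
import Data.Rational.Properties as ℚ
open import Data.Rational.Unnormalised as ℚᵘ using (mkℚᵘ; *≤*; *<*; *≡*)
import Data.Rational.Unnormalised.Properties as ℚᵘ
open import Data.Sum using (_⊎_; inj₁; inj₂)
import Data.Sum as Sum
import Data.Sum.Properties as Sum
open import Data.Unit using (⊤; tt)
open import Data.Vec as Vec using (Vec; []; _∷_)
import Data.Vec.Properties as Vec
open import Defs
open import Function using (_∘_; _⇔_; mk⇔; Equivalence)
open import Level using (0ℓ)
open import Relation.Binary using (DecidableEquality)
open import Relation.Binary.PropositionalEquality
  using (_≡_; _≢_; refl; sym; trans; cong; cong₂; subst; subst₂; module ≡-Reasoning)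
open import Relation.Nullary using (¬_; Dec; yes; no; ¬?; does)
import Relation.Nullary.Decidable as Dec
open import Relation.Nullary.Decidable using (recompute; _→-dec_; _×-dec_)
open import Relation.Unary using (Pred; Decidable)

open Equivalence using (to; from)

-- Located reals against the grid a / K

toℚᵘ-/ : ∀ i n .{{_ : NonZero n}} → toℚᵘ (i / n) ℚᵘ.≃ mkℚᵘ i (n ∸ 1)
toℚᵘ-/ i (suc n) = ℚ.toℚᵘ-fromℚᵘ (mkℚᵘ i n)

/≤/⇔*≤* : ∀ i j m n .{{_ : NonZero m}} .{{_ : NonZero n}} →
          (i / m ℚ.≤ j / n) ⇔ (i ℤ.* + n ℤ.≤ j ℤ.* + m)
/≤/⇔*≤* i j m@(suc _) n@(suc _) = mk⇔
  (λ le → ℚᵘ.drop-*≤* (ℚᵘ.≤-respʳ-≃ (toℚᵘ-/ j n) (ℚᵘ.≤-respˡ-≃ (toℚᵘ-/ i m) (ℚ.toℚᵘ-mono-≤ le))))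
  (λ le → ℚ.toℚᵘ-cancel-≤
    (ℚᵘ.≤-respʳ-≃ (ℚᵘ.≃-sym (toℚᵘ-/ j n)) (ℚᵘ.≤-respˡ-≃ (ℚᵘ.≃-sym (toℚᵘ-/ i m)) (*≤* le))))

/</⇔*<* : ∀ i j m n .{{_ : NonZero m}} .{{_ : NonZero n}} →
          (i / m ℚ.< j / n) ⇔ (i ℤ.* + n ℤ.< j ℤ.* + m)
/</⇔*<* i j m@(suc _) n@(suc _) = mk⇔
  (λ lt → ℚᵘ.drop-*<* (ℚᵘ.<-respʳ-≃ (toℚᵘ-/ j n) (ℚᵘ.<-respˡ-≃ (toℚᵘ-/ i m) (ℚ.toℚᵘ-mono-< lt))))
  (λ lt → ℚ.toℚᵘ-cancel-<
    (ℚᵘ.<-respʳ-≃ (ℚᵘ.≃-sym (toℚᵘ-/ j n)) (ℚᵘ.<-respˡ-≃ (ℚᵘ.≃-sym (toℚᵘ-/ i m)) (*<* lt))))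

instance
  ℕ→ℚ-pos : ∀ {n} .{{_ : NonZero n}} → Positive (ℕ→ℚ n)
  ℕ→ℚ-pos {n} = ℚ.normalize-pos n 1

a/K*K≡a : ∀ a K .{{_ : NonZero K}} → (+ a / K) ℚ.* ℕ→ℚ K ≡ ℕ→ℚ a
a/K*K≡a a K@(suc K-1) = ℚ.toℚᵘ-injective (begin
  toℚᵘ ((+ a / K) ℚ.* ℕ→ℚ K)              ≈⟨ ℚ.toℚᵘ-homo-* (+ a / K) (ℕ→ℚ K) ⟩
  toℚᵘ (+ a / K) ℚᵘ.* toℚᵘ (ℕ→ℚ K)        ≈⟨ ℚᵘ.*-cong (toℚᵘ-/ (+ a) K) (toℚᵘ-/ (+ K) 1) ⟩
  mkℚᵘ (+ a) K-1 ℚᵘ.* mkℚᵘ (+ K) 0        ≈⟨ *≡* (trans (ℤ.*-identityʳ (+ a ℤ.* + K))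
                                                    (cong (λ x → + a ℤ.* + suc x) (sym (ℕ.*-identityʳ K-1)))) ⟩
  mkℚᵘ (+ a) 0                            ≈⟨ toℚᵘ-/ (+ a) 1 ⟨
  toℚᵘ (ℕ→ℚ a)                            ∎)
  where open ℚᵘ.≃-Reasoning

*≤⇔≤/ : ∀ q a K .{{_ : NonZero K}} → (q ℚ.* ℕ→ℚ K ℚ.≤ ℕ→ℚ a) ⇔ (q ℚ.≤ + a / K)
*≤⇔≤/ q a K = mk⇔
  (λ le → ℚ.*-cancelʳ-≤-pos (ℕ→ℚ K) (subst (q ℚ.* ℕ→ℚ K ℚ.≤_) (sym (a/K*K≡a a K)) le))
  (λ le → subst (q ℚ.* ℕ→ℚ K ℚ.≤_) (a/K*K≡a a K)
            (ℚ.*-monoʳ-≤-nonNeg (ℕ→ℚ K) {{ℚ.pos⇒nonNeg (ℕ→ℚ K)}} le))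

≤*⇔/≤ : ∀ q a K .{{_ : NonZero K}} → (ℕ→ℚ a ℚ.≤ q ℚ.* ℕ→ℚ K) ⇔ (+ a / K ℚ.≤ q)
≤*⇔/≤ q a K = mk⇔
  (λ le → ℚ.*-cancelʳ-≤-pos (ℕ→ℚ K) (subst (ℚ._≤ q ℚ.* ℕ→ℚ K) (sym (a/K*K≡a a K)) le))
  (λ le → subst (ℚ._≤ q ℚ.* ℕ→ℚ K) (a/K*K≡a a K)
            (ℚ.*-monoʳ-≤-nonNeg (ℕ→ℚ K) {{ℚ.pos⇒nonNeg (ℕ→ℚ K)}} le))

lower<upper : ∀ (x : ℝ) {q r} → L x q → U x r → q ℚ.< r
lower<upper x {q} {r} Lq Ur with q ℚ.<? r
... | yes q<r = q<r
... | no q≮r =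
  let (q′ , q<q′ , Lq′) = to (L-rounded x q) Lq
  in ⊥-elim (disjoint x q′ (Lq′ , from (U-rounded x q′) (r , ℚ.≤-<-trans (ℚ.≮⇒≥ q≮r) q<q′ , Ur)))

module _ (K : ℕ) .{{_ : NonZero K}} where

  private
    grid : ℕ → ℚ
    grid a = + a / K

  grid-mono-≤ : ∀ {a b} → a ≤ b → grid a ℚ.≤ grid b
  grid-mono-≤ {a} {b} a≤b = from (/≤/⇔*≤* (+ a) (+ b) K K) (ℤ.*-monoʳ-≤-nonNeg (+ K) (ℤ.+≤+ a≤b))

  grid-mono-< : ∀ {a b} → a < b → grid a ℚ.< grid b
  grid-mono-< {a} {b} a<b = from (/</⇔*<* (+ a) (+ b) K K)
    (ℤ.*-monoʳ-<-pos (+ K) {{ℤ.positive (ℤ.+<+ (ℕ.>-nonZero⁻¹ K))}} (ℤ.+<+ a<b))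

  grid-cancel-< : ∀ {a b} → grid a ℚ.< grid b → a < b
  grid-cancel-< lt = ℕ.≰⇒> (λ b≤a → ℚ.<-irrefl refl (ℚ.<-≤-trans lt (grid-mono-≤ b≤a)))

  ·≤ℕ-located : ∀ (x : ℝ) a → x · K ≤ℕ a ⊎ (∀ b → b < a → ¬ x · K ≤ℕ b)
  ·≤ℕ-located x zero = inj₂ (λ _ ())
  ·≤ℕ-located x (suc a) with located x (grid a) (grid (suc a)) (grid-mono-< (ℕ.n<1+n a))
  ... | inj₂ U[1+a] = inj₁ (λ q Lq → from (*≤⇔≤/ q (suc a) K) (ℚ.<⇒≤ (lower<upper x Lq U[1+a])))
  ... | inj₁ L[a] = inj₂ (λ b b<1+a xK≤b →
    let (r , a<r , Lr) = to (L-rounded x (grid a)) L[a]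
    in ℚ.<-irrefl refl (ℚ.<-≤-trans a<r
         (ℚ.≤-trans (to (*≤⇔≤/ r b K) (xK≤b r Lr)) (grid-mono-≤ (ℕ.≤-pred b<1+a)))))

  ≤ℕ·-located : ∀ (x : ℝ) a → a ≤ℕ x · K ⊎ (∀ b → a < b → ¬ b ≤ℕ x · K)
  ≤ℕ·-located x a with located x (grid a) (grid (suc a)) (grid-mono-< (ℕ.n<1+n a))
  ... | inj₁ L[a] = inj₁ (λ q Uq → from (≤*⇔/≤ q a K) (ℚ.<⇒≤ (lower<upper x L[a] Uq)))
  ... | inj₂ U[1+a] = inj₂ (λ b a<b b≤xK →
    let (q , q<1+a , Uq) = to (U-rounded x (grid (suc a))) U[1+a]
    in ℚ.<-irrefl refl (ℚ.<-≤-trans q<1+a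
         (ℚ.≤-trans (grid-mono-≤ a<b) (to (≤*⇔/≤ q b K) (b≤xK q Uq)))))

  ≤ℕ·<1⇒< : ∀ {x : ℝ} {a} → x <1 → a ≤ℕ x · K → a < K
  ≤ℕ·<1⇒< {x} {a} x<1 a≤xK =
    let (q , q<1 , Uq) = to (U-rounded x 1ℚ) x<1
    in grid-cancel-< (ℚ.≤-<-trans (to (≤*⇔/≤ q a K) (a≤xK q Uq))
         (ℚ.<-≤-trans q<1 (to (*≤⇔≤/ 1ℚ K K) (ℚ.≤-reflexive (ℚ.*-identityˡ (ℕ→ℚ K))))))

-- t is the denominator of a rational q with x < q < 1.
<1⇒uniform-gap : ∀ {x : ℝ} → x <1 → Σ ℕ λ t → ∀ K .{{_ : NonZero K}} a → a ≤ℕ x · K → K ≤ t * (K ∸ a)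
<1⇒uniform-gap {x} x<1 = t , gap
  where
  q = proj₁ (to (U-rounded x 1ℚ) x<1)
  q<1 = proj₁ (proj₂ (to (U-rounded x 1ℚ) x<1))
  Uq = proj₂ (proj₂ (to (U-rounded x 1ℚ) x<1))
  t = ↧ₙ q
  q≡↥q/t : ↥ q / t ≡ q
  q≡↥q/t = ℚ.↥p/↧p≡p q
  1+↥q≤t : ℤ.suc (↥ q) ℤ.≤ + t
  1+↥q≤t = ℤ.i<j⇒suc[i]≤j (subst₂ ℤ._<_ (ℤ.*-identityʳ (↥ q)) (ℤ.*-identityˡ (+ t))
             (to (/</⇔*<* (↥ q) (+ 1) t 1) (subst (ℚ._< 1ℚ) (sym q≡↥q/t) q<1)))
  gap : ∀ K .{{_ : NonZero K}} a → a ≤ℕ x · K → K ≤ t * (K ∸ a)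
  gap K a a≤xK = subst (K ≤_) (trans (cong (t * K ∸_) (ℕ.*-comm a t)) (sym (ℕ.*-distribˡ-∸ t K a)))
    (ℕ.m+n≤o⇒m≤o∸n K (ℤ.drop‿+≤+ (begin
      + (K ℕ.+ a * t)                ≡⟨ trans (ℤ.pos-+ K (a * t)) (cong (ℤ._+_ (+ K)) (ℤ.pos-* a t)) ⟩
      + K ℤ.+ + a ℤ.* + t            ≤⟨ ℤ.+-monoʳ-≤ (+ K) a*t≤↥q*K ⟩
      + K ℤ.+ ↥ q ℤ.* + K            ≡⟨ cong (ℤ._+ ↥ q ℤ.* + K) (ℤ.*-identityˡ (+ K)) ⟨
      ℤ.1ℤ ℤ.* + K ℤ.+ ↥ q ℤ.* + K   ≡⟨ ℤ.*-distribʳ-+ (+ K) ℤ.1ℤ (↥ q) ⟨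
      ℤ.suc (↥ q) ℤ.* + K            ≤⟨ ℤ.*-monoʳ-≤-nonNeg (+ K) 1+↥q≤t ⟩
      + t ℤ.* + K                    ≡⟨ ℤ.pos-* t K ⟨
      + (t * K)                      ∎)))
    where
    open ℤ.≤-Reasoning
    a*t≤↥q*K : + a ℤ.* + t ℤ.≤ ↥ q ℤ.* + K
    a*t≤↥q*K = to (/≤/⇔*≤* (+ a) (↥ q) K t)
                 (subst (+ a / K ℚ.≤_) (sym q≡↥q/t) (to (≤*⇔/≤ q a K) (a≤xK q Uq)))

-- Finite combinatorics

minimal-unique : ∀ (P : ℕ → Set) {a b} → P a → P b →
                 (∀ c → c < a → ¬ P c) → (∀ c → c < b → ¬ P c) → a ≡ b
minimal-unique P Pa Pb a-min b-min =
  ℕ.≤-antisym (ℕ.≮⇒≥ (λ b<a → a-min _ b<a Pb)) (ℕ.≮⇒≥ (λ a<b → b-min _ a<b Pa))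

maximal-unique : ∀ (P : ℕ → Set) {a b} → P a → P b →
                 (∀ c → a < c → ¬ P c) → (∀ c → b < c → ¬ P c) → a ≡ b
maximal-unique P Pa Pb a-max b-max =
  ℕ.≤-antisym (ℕ.≮⇒≥ (λ b<a → b-max _ b<a Pa)) (ℕ.≮⇒≥ (λ a<b → a-max _ a<b Pb))

mod-injective : ∀ {n x y} .{{_ : NonZero n}} → x < n → y < n → x mod n ≡ y mod n → x ≡ y
mod-injective {n} {x} {y} x<n y<n eq = begin
  x              ≡⟨ m<n⇒m%n≡m x<n ⟨
  x % n          ≡⟨ Fin.toℕ-fromℕ< _ ⟨
  toℕ (x mod n)  ≡⟨ cong toℕ eq ⟩
  toℕ (y mod n)  ≡⟨ Fin.toℕ-fromℕ< _ ⟩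
  y % n          ≡⟨ m<n⇒m%n≡m y<n ⟩
  y              ∎
  where open ≡-Reasoning

subsets : ∀ K → List (Subset K)
subsets zero = [ [] ]
subsets (suc K) = cartesianProductWith _∷_ (inside ∷ outside ∷ []) (subsets K)

∈-subsets : ∀ {K} (B : Subset K) → B ∈ˡ subsets K
∈-subsets [] = here refl
∈-subsets (inside ∷ B) = ∈-cartesianProductWith⁺ _∷_ {xs = inside ∷ outside ∷ []} (here refl) (∈-subsets B)
∈-subsets (outside ∷ B) =
  ∈-cartesianProductWith⁺ _∷_ {xs = inside ∷ outside ∷ []} (there (here refl)) (∈-subsets B)

subsets-unique : ∀ K → Unique (subsets K)
subsets-unique zero = All.[] ∷ []
subsets-unique (suc K) =
  Unique.cartesianProductWith⁺ _∷_ Vec.∷-injective (((λ ()) All.∷ All.[]) ∷ All.[] ∷ []) (subsets-unique K)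

_≟ˢ_ : ∀ {K} → DecidableEquality (Subset K)
_≟ˢ_ = Vec.≡-dec Bool._≟_

module _ {A : Set} where

  lookup-injective : ∀ {xs : List A} → Unique xs → ∀ {i j} → lookup xs i ≡ lookup xs j → i ≡ j
  lookup-injective {x ∷ xs} (x∉xs ∷ u) {zero}  {zero}  _ = refl
  lookup-injective {x ∷ xs} (x∉xs ∷ u) {zero}  {suc j} x≡ = ⊥-elim (All.lookup x∉xs (∈-lookup j) x≡)
  lookup-injective {x ∷ xs} (x∉xs ∷ u) {suc i} {zero}  ≡x = ⊥-elim (All.lookup x∉xs (∈-lookup i) (sym ≡x))
  lookup-injective {x ∷ xs} (x∉xs ∷ u) {suc i} {suc j} eq = cong suc (lookup-injective u eq)

  lookup-++ˡ : ∀ (xs ys : List A) (i : Fin (length (xs ++ ys))) (j : Fin (length xs)) →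
               toℕ i ≡ toℕ j → lookup (xs ++ ys) i ≡ lookup xs j
  lookup-++ˡ (x ∷ xs) ys zero zero _ = refl
  lookup-++ˡ (x ∷ xs) ys (suc i) (suc j) eq = lookup-++ˡ xs ys i j (ℕ.suc-injective eq)

  unique-⊆⇒length≤ : ∀ {xs ys : List A} → Unique xs → xs ⊆ˡ ys → length xs ≤ length ys
  unique-⊆⇒length≤ {xs} {ys} u xs⊆ys = Fin.injective⇒≤ {f = index-in-ys} index-in-ys-injective
    where
    index-in-ys : Fin (length xs) → Fin (length ys)
    index-in-ys i = index (xs⊆ys (∈-lookup i))
    index-in-ys-injective : ∀ {i j} → index-in-ys i ≡ index-in-ys j → i ≡ j
    index-in-ys-injective {i} {j} eq = lookup-injective u
      (trans (lookup-index (xs⊆ys (∈-lookup i)))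
        (trans (cong (lookup ys) eq) (sym (lookup-index (xs⊆ys (∈-lookup j))))))

  unique-image-length≤ : ∀ {n} (g : Fin n → Maybe A) {xs : List A} → Unique xs →
                         (∀ {x} → x ∈ˡ xs → ∃ λ j → g j ≡ just x) → length xs ≤ n
  unique-image-length≤ g {xs} u image = Fin.injective⇒≤ {f = owner} owner-injective
    where
    owner : Fin (length xs) → Fin _
    owner i = proj₁ (image (∈-lookup i))
    owner-injective : ∀ {i j} → owner i ≡ owner j → i ≡ j
    owner-injective {i} {j} e = lookup-injective u (Maybe.just-injective
      (trans (sym (proj₂ (image (∈-lookup i)))) (trans (cong g e) (proj₂ (image (∈-lookup j))))))

module _ {A : Set} (_≟_ : DecidableEquality A) where

  open DecMembership _≟_ using () renaming (_∈?_ to _∈ˡ?_)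

  position : A → List A → ℕ
  position x xs with x ∈ˡ? xs
  ... | yes x∈xs = toℕ (index x∈xs)
  ... | no _ = 0

  position-< : ∀ {x xs} → x ∈ˡ xs → position x xs < length xs
  position-< {x} {xs} x∈xs with x ∈ˡ? xs
  ... | yes x∈xs′ = Fin.toℕ<n (index x∈xs′)
  ... | no x∉xs = ⊥-elim (x∉xs x∈xs)

  position-injective : ∀ {x y xs} → x ∈ˡ xs → y ∈ˡ xs → position x xs ≡ position y xs → x ≡ y
  position-injective {x} {y} {xs} x∈xs y∈xs eq with x ∈ˡ? xs | y ∈ˡ? xs
  ... | yes x∈ | yes y∈ =
    trans (lookup-index x∈) (trans (cong (lookup xs) (Fin.toℕ-injective eq)) (sym (lookup-index y∈)))
  ... | no x∉ | _ = ⊥-elim (x∉ x∈xs)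
  ... | _ | no y∉ = ⊥-elim (y∉ y∈xs)

  extend : ∀ d (xs ys : List A) → Unique xs → Unique ys → xs ⊆ˡ ys → length xs ≤ d → d ≤ length ys →
           Σ (Fin d → A) λ f → (∀ {i j} → f i ≡ f j → i ≡ j) ×
                               (∀ {x} → x ∈ˡ xs → ∃ λ i → f i ≡ x) ×
                               (∀ i → f i ∈ˡ ys)
  extend d xs ys xs-unique ys-unique xs⊆ys |xs|≤d d≤|ys| = f , f-injective , f-hits , f-within
    where
    rest = filter (λ y → ¬? (y ∈ˡ? xs)) ys
    zs = xs ++ rest
    zs-unique : Unique zs
    zs-unique = Unique.++⁺ xs-unique (Unique.filter⁺ _ ys-unique)
                  (λ (x∈xs , x∈rest) → proj₂ (∈-filter⁻ _ {xs = ys} x∈rest) x∈xs)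
    ys⊆zs : ys ⊆ˡ zs
    ys⊆zs {y} y∈ys with y ∈ˡ? xs
    ... | yes y∈xs = ∈-++⁺ˡ y∈xs
    ... | no y∉xs = ∈-++⁺ʳ xs (∈-filter⁺ _ y∈ys y∉xs)
    zs⊆ys : zs ⊆ˡ ys
    zs⊆ys z∈zs with ∈-++⁻ xs z∈zs
    ... | inj₁ z∈xs = xs⊆ys z∈xs
    ... | inj₂ z∈rest = proj₁ (∈-filter⁻ _ {xs = ys} z∈rest)
    d≤|zs| : d ≤ length zs
    d≤|zs| = ℕ.≤-trans d≤|ys| (unique-⊆⇒length≤ ys-unique ys⊆zs)
    f : Fin d → A
    f i = lookup zs (inject≤ i d≤|zs|)
    f-injective : ∀ {i j} → f i ≡ f j → i ≡ j
    f-injective eq = Fin.inject≤-injective d≤|zs| d≤|zs| _ _ (lookup-injective zs-unique eq)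
    f-hits : ∀ {x} → x ∈ˡ xs → ∃ λ i → f i ≡ x
    f-hits x∈xs = i , trans (lookup-++ˡ xs rest _ k toℕ-i≡toℕ-k) (sym (lookup-index x∈xs))
      where
      k = index x∈xs
      i = inject≤ k |xs|≤d
      toℕ-i≡toℕ-k = trans (Fin.toℕ-inject≤ i d≤|zs|) (Fin.toℕ-inject≤ k |xs|≤d)
    f-within : ∀ i → f i ∈ˡ ys
    f-within i = zs⊆ys (∈-lookup (inject≤ i d≤|zs|))

sum-≤ : ∀ {n} (f : Fin n → ℕ) {e} → (∀ i → f i ≤ e) → ∑[ i < n ] f i ≤ n * e
sum-≤ {zero} f f≤e = z≤n
sum-≤ {suc n} f f≤e = ℕ.+-mono-≤ (f≤e zero) (sum-≤ (f ∘ suc) (f≤e ∘ suc))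

∣∣≡∑∈ : ∀ {K} (B : Subset K) → ∣ B ∣ ≡ ∑[ pt < K ] (if does (pt ∈? B) then 1 else 0)
∣∣≡∑∈ [] = refl
∣∣≡∑∈ (inside ∷ B) = cong suc (∣∣≡∑∈ B)
∣∣≡∑∈ (outside ∷ B) = ∣∣≡∑∈ B

module _ {K : ℕ} {A : Set} (C : A → Subset K) where

  count : Fin K → List A → ℕ
  count pt xs = length (filter (λ x → pt ∈? C x) xs)

  count-∷ : ∀ pt x xs → count pt (x ∷ xs) ≡ (if does (pt ∈? C x) then 1 else 0) + count pt xs
  count-∷ pt x xs with does (pt ∈? C x)
  ... | true = refl
  ... | false = refl

  length*K≤t*∑count : ∀ t xs → (∀ {x} → x ∈ˡ xs → K ≤ t * ∣ C x ∣) →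
                      length xs * K ≤ t * ∑[ pt < K ] count pt xs
  length*K≤t*∑count t [] _ = z≤n
  length*K≤t*∑count t (x ∷ xs) large = begin
    K + length xs * K                               ≤⟨ ℕ.+-mono-≤ (large (here refl))
                                                                  (length*K≤t*∑count t xs (large ∘ there)) ⟩
    t * ∣ C x ∣ + t * ∑[ pt < K ] count pt xs       ≡⟨ ℕ.*-distribˡ-+ t ∣ C x ∣ _ ⟨
    t * (∣ C x ∣ + ∑[ pt < K ] count pt xs)         ≡⟨ cong (λ c → t * (c + _)) (∣∣≡∑∈ (C x)) ⟩
    t * (∑[ pt < K ] _ + ∑[ pt < K ] count pt xs)   ≡⟨ cong (t *_) (∑-distrib-+ _ (λ pt → count pt xs)) ⟨
    t * ∑[ pt < K ] (_ + count pt xs)               ≡⟨ cong (t *_) (sum-cong-≗ (λ pt → count-∷ pt x xs)) ⟨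
    t * ∑[ pt < K ] count pt (x ∷ xs)               ∎
    where open ℕ.≤-Reasoning

  double-counting : ∀ t e xs .{{_ : NonZero K}} → (∀ {x} → x ∈ˡ xs → K ≤ t * ∣ C x ∣) →
                    (∀ pt → count pt xs ≤ e) → length xs ≤ t * e
  double-counting t e xs large sparse = ℕ.*-cancelʳ-≤ (length xs) (t * e) K (begin
    length xs * K                  ≤⟨ length*K≤t*∑count t xs large ⟩
    t * ∑[ pt < K ] count pt xs    ≤⟨ ℕ.*-monoʳ-≤ t (sum-≤ (λ pt → count pt xs) sparse) ⟩
    t * (K * e)                    ≡⟨ cong (t *_) (ℕ.*-comm K e) ⟩
    t * (e * K)                    ≡⟨ ℕ.*-assoc t e K ⟨
    t * e * K                      ∎)
    where open ℕ.≤-Reasoning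

-- Exhaustive search

Searchable : Set → Set₁
Searchable A = ∀ {P : Pred A 0ℓ} → Decidable P → Dec (∃ P)

searchable-× : ∀ {A B : Set} → Searchable A → Searchable B → Searchable (A × B)
searchable-× search-A search-B P? =
  Dec.map′ (λ (a , b , p) → (a , b) , p) (λ ((a , b) , p) → a , b , p)
    (search-A (λ a → search-B (λ b → P? (a , b))))

searchable-Vec : ∀ {A : Set} → Searchable A → ∀ n → Searchable (Vec A n)
searchable-Vec search-A zero P? = Dec.map′ (λ p → [] , p) (λ { ([] , p) → p }) (P? [])
searchable-Vec search-A (suc n) P? =
  Dec.map′ (λ ((x , xs) , p) → x ∷ xs , p) (λ { (x ∷ xs , p) → (x , xs) , p })
    (searchable-× search-A (searchable-Vec search-A n) (λ (x , xs) → P? (x ∷ xs)))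

searchable-→ : ∀ {A : Set} → Searchable A → ∀ n {P : Pred (Fin n → A) 0ℓ} →
               (∀ {f g} → (∀ i → f i ≡ g i) → P f → P g) → Decidable P → Dec (∃ P)
searchable-→ search-A n P-resp P? =
  Dec.map′ (λ (v , p) → Vec.lookup v , p)
           (λ (f , p) → Vec.tabulate f , P-resp (λ i → sym (Vec.lookup∘tabulate f i)) p)
    (searchable-Vec search-A n (P? ∘ Vec.lookup))

Table : ℕ → Set → Set
Table zero A = A
Table (suc K) A = Table K A × Table K A

module _ {A : Set} where

  lookupᵀ : ∀ {K} → Table K A → Subset K → A
  lookupᵀ t [] = t
  lookupᵀ (t , _) (inside ∷ B) = lookupᵀ t B
  lookupᵀ (_ , t) (outside ∷ B) = lookupᵀ t B

  tabulateᵀ : ∀ {K} → (Subset K → A) → Table K A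
  tabulateᵀ {zero} f = f []
  tabulateᵀ {suc K} f = tabulateᵀ (f ∘ (inside ∷_)) , tabulateᵀ (f ∘ (outside ∷_))

  lookupᵀ∘tabulateᵀ : ∀ {K} (f : Subset K → A) B → lookupᵀ (tabulateᵀ f) B ≡ f B
  lookupᵀ∘tabulateᵀ f [] = refl
  lookupᵀ∘tabulateᵀ f (inside ∷ B) = lookupᵀ∘tabulateᵀ (f ∘ (inside ∷_)) B
  lookupᵀ∘tabulateᵀ f (outside ∷ B) = lookupᵀ∘tabulateᵀ (f ∘ (outside ∷_)) B

  searchable-Table : Searchable A → ∀ K → Searchable (Table K A)
  searchable-Table search-A zero = search-A
  searchable-Table search-A (suc K) = searchable-× (searchable-Table search-A K) (searchable-Table search-A K)

module _ (a b c : ℕ) where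

  encode : Maybe (Fin a ⊎ (Fin b × Fin c)) → Fin (suc (a + b * c))
  encode nothing = zero
  encode (just (inj₁ x)) = suc (x ↑ˡ (b * c))
  encode (just (inj₂ (y , z))) = suc (a ↑ʳ combine y z)

  decode : Fin (suc (a + b * c)) → Maybe (Fin a ⊎ (Fin b × Fin c))
  decode zero = nothing
  decode (suc x) = just (Sum.map₂ (remQuot c) (splitAt a x))

  decode∘encode : ∀ x → decode (encode x) ≡ x
  decode∘encode nothing = refl
  decode∘encode (just (inj₁ x)) = cong (just ∘ Sum.map₂ (remQuot c)) (Fin.splitAt-↑ˡ a x (b * c))
  decode∘encode (just (inj₂ (y , z))) =
    trans (cong (just ∘ Sum.map₂ (remQuot c)) (Fin.splitAt-↑ʳ a (b * c) (combine y z)))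
          (cong (just ∘ inj₂) (Fin.remQuot-combine y z))

  encode-injective : ∀ {x y} → encode x ≡ encode y → x ≡ y
  encode-injective {x} {y} e = trans (sym (decode∘encode x)) (trans (cong decode e) (decode∘encode y))

-- Levels, zones and colourings

module Colourings (k : ℕ → ℕ) (α β : ℝ) (d : ℕ) (k≥1 : ∀ n → 1 ≤ k n) (β<1 : β <1) (d≥1 : 1 ≤ d) where

  open Setting k α β d

  instance
    d≢0 : NonZero d
    d≢0 = ℕ.>-nonZero d≥1

  Covers : ∀ {K} → (Fin d → Subset K) → Set
  Covers A = ∀ pt → ∃ λ j → pt ∈ A j

  ≈-sym : ∀ {x y} → x ≈ y → y ≈ x
  ≈-sym x≈y p = mk⇔ (from (x≈y p)) (to (x≈y p))

  ≈-trans : ∀ {x y z} → x ≈ y → y ≈ z → x ≈ z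
  ≈-trans x≈y y≈z p = mk⇔ (to (y≈z p) ∘ to (x≈y p)) (from (x≈y p) ∘ from (y≈z p))

  module AtLevel (n : ℕ) where

    K : ℕ
    K = k n

    instance
      K≢0 : NonZero K
      K≢0 = ℕ.>-nonZero (k≥1 n)

    pt₀ : Fin K
    pt₀ = fromℕ< (k≥1 n)

    LowOK UpOK InR : ℕ → Set
    LowOK a = α · K ≤ℕ a
    UpOK a = a ≤ℕ β · K
    InR a = LowOK a × UpOK a

    data Zone (a : ℕ) : Set where
      mid  : InR a → Zone a
      low  : (∀ b → b < a → ¬ LowOK b) → Zone a
      high : (∀ b → a < b → ¬ UpOK b) → Zone a

    zoneOf : ∀ {a} → LowOK a ⊎ (∀ b → b < a → ¬ LowOK b) → UpOK a ⊎ (∀ b → a < b → ¬ UpOK b) → Zone a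
    zoneOf (inj₂ below) _            = low below
    zoneOf (inj₁ α≤a)   (inj₂ above) = high above
    zoneOf (inj₁ α≤a)   (inj₁ a≤β)   = mid (α≤a , a≤β)

    zone : ∀ a → Zone a
    zone a = zoneOf (·≤ℕ-located K α a) (≤ℕ·-located K β a)

    kind : ∀ {a} → Zone a → Fin 3
    kind (mid _)  = 0F
    kind (low _)  = 1F
    kind (high _) = 2F

    mid-inRange : ∀ {a} (z : Zone a) → kind z ≡ 0F → InR a
    mid-inRange (mid p) _ = p

    nonmid-unique : ∀ {a b} → InR a → InR b → kind (zone a) ≡ kind (zone b) → kind (zone a) ≢ 0F → a ≡ b
    nonmid-unique p q = same-kind p q (zone _) (zone _)
      where
      same-kind : ∀ {a b} → InR a → InR b → (za : Zone a) (zb : Zone b) →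
                  kind za ≡ kind zb → kind za ≢ 0F → a ≡ b
      same-kind p q (mid _) _ _ nonmid = ⊥-elim (nonmid refl)
      same-kind p q (low a-min) (low b-min) _ _ = minimal-unique LowOK (proj₁ p) (proj₁ q) a-min b-min
      same-kind p q (high a-max) (high b-max) _ _ = maximal-unique UpOK (proj₂ p) (proj₂ q) a-max b-max
      same-kind p q (low _) (mid _) () _
      same-kind p q (low _) (high _) () _
      same-kind p q (high _) (mid _) () _
      same-kind p q (high _) (low _) () _

    ι-≈⇒≡ : ∀ {x y : 𝔛ₙ n} → ι n x ≈ ι n y → proj₁ x ≡ proj₁ y
    ι-≈⇒≡ {x} {y} x≈y = ⊆-antisym (⊆ x y x≈y) (⊆ y x (≈-sym {ι n x} {ι n y} x≈y))
      where
      ⊆ : ∀ x y → ι n x ≈ ι n y → ∀ {i} → i ∈ proj₁ x → i ∈ proj₁ y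
      ⊆ x y x≈y {i} i∈x = same-level (to (x≈y (n , i)) (refl , i∈x))
        where
        same-level : ι n y ∋ (n , i) → i ∈ proj₁ y
        same-level (refl , i∈y) = i∈y

    ≡⇒ι-≈ : ∀ {x y : 𝔛ₙ n} → proj₁ x ≡ proj₁ y → ι n x ≈ ι n y
    ≡⇒ι-≈ {A , _} {.A , _} refl _ = mk⇔ (λ x∋p → x∋p) (λ y∋p → y∋p)

    color0⇒covers : ∀ (g : Fin d → 𝔛ₙ n) → Color0 (ι n ∘ g) → Covers (proj₁ ∘ g)
    color0⇒covers g (n′ , cov) with cov (fromℕ< (k≥1 n′))
    ... | _ , refl , _ = λ pt → member (cov pt)
      where
      member : ∀ {pt} → Σ (Fin d) (λ j → ι n (g j) ∋ (n , pt)) → ∃ λ j → pt ∈ proj₁ (g j)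
      member (j , refl , pt∈) = j , pt∈

    covers⇒color0 : ∀ (g : Fin d → 𝔛ₙ n) → Covers (proj₁ ∘ g) → Color0 (ι n ∘ g)
    covers⇒color0 g cov = n , λ pt → proj₁ (cov pt) , refl , proj₂ (cov pt)

    inRange⇒¬full : ∀ {A} → InRange n A → ¬ (∀ pt → pt ∈ A)
    inRange⇒¬full {A} (_ , A≤β) all-in = ℕ.<-irrefl ∣A∣≡K (≤ℕ·<1⇒< K {β} {∣ A ∣} β<1 A≤β)
      where
      ∣A∣≡K : ∣ A ∣ ≡ K
      ∣A∣≡K = trans (cong ∣_∣ (⊆-antisym (λ _ → ∈⊤) (λ {pt} _ → all-in pt))) (∣⊤∣≡n K)

    single-cover-impossible : ∀ {A : Fin d → Subset K} {B} → InRange n B → Covers A → ¬ (∀ j → A j ≡ B)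
    single-cover-impossible B-inRange cov A≡B =
      inRange⇒¬full B-inRange (λ pt → subst (pt ∈_) (A≡B (proj₁ (cov pt))) (proj₂ (cov pt)))

    atLevelᵈ : (x : 𝔛) → Dec (proj₁ x ≡ n) → Maybe (𝔛ₙ n)
    atLevelᵈ (_ , y) (yes refl) = just y
    atLevelᵈ _ (no _) = nothing

    atLevel : 𝔛 → Maybe (𝔛ₙ n)
    atLevel x = atLevelᵈ x (proj₁ x ℕ.≟ n)

    atLevel-∋ : ∀ x {pt} → x ∋ (n , pt) → ∃ λ y → atLevel x ≡ just y × pt ∈ proj₁ y
    atLevel-∋ x@(_ , y) {pt} (refl , pt∈) = by-level (n ℕ.≟ n)
      where
      by-level : (D : Dec (n ≡ n)) → ∃ λ y′ → atLevelᵈ x D ≡ just y′ × pt ∈ proj₁ y′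
      by-level (yes refl) = y , refl , pt∈
      by-level (no n≢n) = ⊥-elim (n≢n refl)

    atLevel-sound : ∀ x {y} → atLevel x ≡ just y → x ≡ ι n y
    atLevel-sound x = by-level (proj₁ x ℕ.≟ n)
      where
      by-level : ∀ {y} (D : Dec (proj₁ x ≡ n)) → atLevelᵈ x D ≡ just y → x ≡ ι n y
      by-level (yes refl) refl = refl

  χ≤⇒χₙ≤ : ∀ n m → χ≤ m → χₙ≤ n m
  χ≤⇒χₙ≤ n m (f , f-resp , f-proper) =
    f ∘ ι n ,
    (λ x y x≈y → f-resp (ι n x) (ι n y) (≡⇒ι-≈ {x} {y} x≈y)) ,
    (λ g distinct color0 → f-proper (ι n ∘ g) (λ i j i≢j → distinct i j i≢j ∘ ι-≈⇒≡ {g i} {g j}) color0)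
    where open AtLevel n

  χ≤⇒trivial : ∀ {m} → χ≤ m → InIdeal (λ _ → ⊤)
  χ≤⇒trivial {m} (f , _ , f-proper) =
    [] , m , (λ c x → f x ≡ c) ,
    (λ c → inj₂ λ 𝒜 distinct in-c color0 →
       f-proper 𝒜 distinct color0 (λ i j → trans (in-c i) (sym (in-c j)))) ,
    (λ x _ → inj₂ (f x , refl))

  MonoEdge : ∀ {K M} → (Subset K → Set) → (Subset K → Fin M) → (Fin d → Subset K) → Set
  MonoEdge V c A = (∀ j → V (A j)) × Distinct _≡_ A × Covers A × (∀ i j → c (A i) ≡ c (A j))

  ProperOn : ∀ {K M} → (Subset K → Set) → (Subset K → Fin M) → Set
  ProperOn V c = ∀ A → ¬ MonoEdge V c A

  module _ {K M : ℕ} {V : Subset K → Set} (V? : Decidable V) where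

    MonoEdge-resp : ∀ {c : Subset K → Fin M} {A B} → (∀ j → A j ≡ B j) → MonoEdge V c A → MonoEdge V c B
    MonoEdge-resp {c} A≗B (inV , distinct , covers , mono) =
      (λ j → subst V (A≗B j) (inV j)) ,
      (λ i j i≢j Bi≡Bj → distinct i j i≢j (trans (A≗B i) (trans Bi≡Bj (sym (A≗B j))))) ,
      (λ pt → let (j , pt∈) = covers pt in j , subst (pt ∈_) (A≗B j) pt∈) ,
      (λ i j → trans (cong c (sym (A≗B i))) (trans (mono i j) (cong c (A≗B j))))

    monoEdge? : ∀ (c : Subset K → Fin M) → Decidable (MonoEdge V c)
    monoEdge? c A =
      Fin.all? (V? ∘ A) ×-dec
      Fin.all? (λ i → Fin.all? λ j → ¬? (i Fin.≟ j) →-dec ¬? (A i ≟ˢ A j)) ×-dec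
      Fin.all? (λ pt → Fin.any? λ j → pt ∈? A j) ×-dec
      Fin.all? (λ i → Fin.all? λ j → c (A i) Fin.≟ c (A j))

    properOn? : ∀ (c : Subset K → Fin M) → Dec (ProperOn V c)
    properOn? c = Dec.map′ (λ ∄ A edge → ∄ (A , edge)) (λ proper (A , edge) → proper A edge)
                    (¬? (searchable-→ anySubset? d (MonoEdge-resp {c}) (monoEdge? c)))

    ProperOn-resp : ∀ {c c′ : Subset K → Fin M} → (∀ B → c B ≡ c′ B) → ProperOn V c → ProperOn V c′
    ProperOn-resp c≗c′ proper A (inV , distinct , covers , mono) =
      proper A (inV , distinct , covers , λ i j → trans (c≗c′ (A i)) (trans (mono i j) (sym (c≗c′ (A j)))))

    -- The witness is irrelevant, so the colouring found does not depend on how its existence was proved.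
    canonical : .(∃ (ProperOn {M = M} V)) → ∃ λ (T : Table K (Fin M)) → ProperOn V (lookupᵀ T)
    canonical proper = recompute (searchable-Table Fin.any? K (properOn? ∘ lookupᵀ)) (tabulated proper)
      where
      tabulated : ∃ (ProperOn {M = M} V) → ∃ λ (T : Table K (Fin M)) → ProperOn V (lookupᵀ T)
      tabulated (c , proper) = tabulateᵀ c , ProperOn-resp (λ B → sym (lookupᵀ∘tabulateᵀ c B)) proper

  -- χ(ℋ₀(𝒸)) ≤ sup χ(ℋ₀(𝒸ₙ)) · d

  module FromLevelColourings (m : ℕ) (χₙ≤m : supχₙ≤ m) where

    _≟ᵐ_ : DecidableEquality (Maybe (Fin m))
    _≟ᵐ_ = Maybe.≡-dec Fin._≟_

    module Labelling (n : ℕ) where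

      open AtLevel n

      colour : 𝔛ₙ n → Fin m
      colour = proj₁ (χₙ≤m n)

      colour-resp : ∀ A (p q : InRange n A) → colour (A , p) ≡ colour (A , q)
      colour-resp A p q = proj₁ (proj₂ (χₙ≤m n)) (A , p) (A , q) refl

      colour-proper : ∀ (g : Fin d → 𝔛ₙ n) → Distinct _≈ₙ_ g → Color0 (ι n ∘ g) →
                      ¬ (∀ i j → colour (g i) ≡ colour (g j))
      colour-proper = proj₂ (proj₂ (χₙ≤m n))

      InClass : Fin m → Subset K → Set
      InClass c B = Σ (InRange n B) λ p → colour (B , p) ≡ c

      colourClass : (Subset K → Maybe (Fin m)) → Fin m → List (Subset K)
      colourClass κ c = filter (λ B → κ B ≟ᵐ just c) (subsets K)

      colourClass-unique : ∀ κ c → Unique (colourClass κ c)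
      colourClass-unique κ c = Unique.filter⁺ _ (subsets-unique K)

      colourClass⁻ : ∀ {κ c B} → B ∈ˡ colourClass κ c → κ B ≡ just c
      colourClass⁻ {κ} {c} B∈ = proj₂ (∈-filter⁻ (λ B → κ B ≟ᵐ just c) {xs = subsets K} B∈)

      colourClass⁺ : ∀ {κ c B} → κ B ≡ just c → B ∈ˡ colourClass κ c
      colourClass⁺ {κ} {c} {B} = ∈-filter⁺ (λ B → κ B ≟ᵐ just c) (∈-subsets B)

      colourClass-cong : ∀ {κ κ′} c → (∀ B → κ B ≡ κ′ B) → colourClass κ c ≡ colourClass κ′ c
      colourClass-cong c κ≗κ′ =
        List.filter-≐ _ _ ((λ {B} → trans (sym (κ≗κ′ B))) , (λ {B} → trans (κ≗κ′ B))) (subsets K)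

      midColourᶻ : (B : Subset K) → Zone ∣ B ∣ → Maybe (Fin m)
      midColourᶻ B (mid p)  = just (colour (B , p))
      midColourᶻ B (low _)  = nothing
      midColourᶻ B (high _) = nothing

      Mid : Fin m → List (Subset K)
      Mid = colourClass (λ B → midColourᶻ B (zone ∣ B ∣))

      layerColourᵈ : ∀ a → InR a → (B : Subset K) → Dec (∣ B ∣ ≡ a) → Maybe (Fin m)
      layerColourᵈ a p B (yes refl) = just (colour (B , p))
      layerColourᵈ a p B (no _) = nothing

      Layer : ∀ a → InR a → Fin m → List (Subset K)
      Layer a p = colourClass (λ B → layerColourᵈ a p B (∣ B ∣ ℕ.≟ a))

      Layer-cong : ∀ {a b} (p : InR a) (q : InR b) c → a ≡ b → Layer a p c ≡ Layer b q c
      Layer-cong {a} p q c refl = colourClass-cong c (λ B → irrelevant B (∣ B ∣ ℕ.≟ a))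
        where
        irrelevant : ∀ B D → layerColourᵈ a p B D ≡ layerColourᵈ a q B D
        irrelevant B (yes refl) = cong just (colour-resp B p q)
        irrelevant B (no _) = refl

      Mid-inClass : ∀ {c B} → B ∈ˡ Mid c → InClass c B
      Mid-inClass {c} {B} = by-zone (zone ∣ B ∣) ∘ colourClass⁻
        where
        by-zone : ∀ z → midColourᶻ B z ≡ just c → InClass c B
        by-zone (mid p) e = p , Maybe.just-injective e

      Mid-mid : ∀ {c B} → B ∈ˡ Mid c → kind (zone ∣ B ∣) ≡ 0F
      Mid-mid {c} {B} = by-zone (zone ∣ B ∣) ∘ colourClass⁻
        where
        by-zone : ∀ z → midColourᶻ B z ≡ just c → kind z ≡ 0F
        by-zone (mid _) _ = refl

      Layer-inClass : ∀ {a} (p : InR a) {c B} → B ∈ˡ Layer a p c → InClass c B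
      Layer-inClass {a} p {c} {B} = by-size (∣ B ∣ ℕ.≟ a) ∘ colourClass⁻
        where
        by-size : ∀ D → layerColourᵈ a p B D ≡ just c → InClass c B
        by-size (yes refl) e = p , Maybe.just-injective e

      Layer-size : ∀ {a} (p : InR a) {c B} → B ∈ˡ Layer a p c → ∣ B ∣ ≡ a
      Layer-size {a} p {c} {B} = by-size (∣ B ∣ ℕ.≟ a) ∘ colourClass⁻
        where
        by-size : ∀ D → layerColourᵈ a p B D ≡ just c → ∣ B ∣ ≡ a
        by-size (yes ∣B∣≡a) _ = ∣B∣≡a

      ∈-Mid : ∀ {A} (p : InRange n A) (q : InR ∣ A ∣) → zone ∣ A ∣ ≡ mid q → A ∈ˡ Mid (colour (A , p))
      ∈-Mid {A} p q e = colourClass⁺ (trans (cong (midColourᶻ A) e) (cong just (colour-resp A q p)))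

      ∈-Layer : ∀ {A} (p : InRange n A) → A ∈ˡ Layer ∣ A ∣ p (colour (A , p))
      ∈-Layer {A} p = colourClass⁺ (by-size (∣ A ∣ ℕ.≟ ∣ A ∣))
        where
        by-size : ∀ D → layerColourᵈ ∣ A ∣ p A D ≡ just (colour (A , p))
        by-size (yes refl) = refl
        by-size (no ∣A∣≢∣A∣) = ⊥-elim (∣A∣≢∣A∣ refl)

      rawLabelᶻ : (A : Subset K) → InRange n A → Zone ∣ A ∣ → ℕ
      rawLabelᶻ A p (mid _)  = position _≟ˢ_ A (Mid (colour (A , p)))
      rawLabelᶻ A p (high _) =
        length (Mid (colour (A , p))) + position _≟ˢ_ A (Layer ∣ A ∣ p (colour (A , p)))
      rawLabelᶻ A p (low _)  = d ∸ suc (position _≟ˢ_ A (Layer ∣ A ∣ p (colour (A , p))))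

      rawLabel : 𝔛ₙ n → ℕ
      rawLabel (A , p) = rawLabelᶻ A p (zone ∣ A ∣)

      rawLabel-resp : ∀ A (p q : InRange n A) → rawLabel (A , p) ≡ rawLabel (A , q)
      rawLabel-resp A p q = by-zone (zone ∣ A ∣)
        where
        same-colour = colour-resp A p q
        same-layer = trans (Layer-cong p q _ refl) (cong (Layer ∣ A ∣ q) same-colour)
        by-zone : ∀ z → rawLabelᶻ A p z ≡ rawLabelᶻ A q z
        by-zone (mid _)  = cong (position _≟ˢ_ A ∘ Mid) same-colour
        by-zone (high _) = cong₂ (λ c L → length (Mid c) + position _≟ˢ_ A L) same-colour same-layer
        by-zone (low _)  = cong (λ L → d ∸ suc (position _≟ˢ_ A L)) same-layer

    -- ∅ lies in 𝔛ₙ for every n when α = 0, and these copies are ≈-equal, so its colour cannot depend on n.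
    emptyColour : ∀ {m′} → Fin m′ → Fin (m′ * d)
    emptyColour {suc m′} _ = combine {suc m′} zero (fromℕ< d≥1)

    emptyColour-const : ∀ {m′} (x y : Fin m′) → emptyColour x ≡ emptyColour y
    emptyColour-const {suc _} _ _ = refl

    colourAt : ∀ n (x : 𝔛ₙ n) → Dec (Nonempty (proj₁ x)) → Fin (m * d)
    colourAt n x (yes _) = combine (Labelling.colour n x) (Labelling.rawLabel n x mod d)
    colourAt n x (no _) = emptyColour (Labelling.colour n x)

    colour𝔛 : 𝔛 → Fin (m * d)
    colour𝔛 (n , x) = colourAt n x (nonempty? (proj₁ x))

    colour𝔛-nonempty : ∀ n (x : 𝔛ₙ n) → Nonempty (proj₁ x) →
                       colour𝔛 (n , x) ≡ combine (Labelling.colour n x) (Labelling.rawLabel n x mod d)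
    colour𝔛-nonempty n x x≢∅ = by-emptiness (nonempty? (proj₁ x))
      where
      by-emptiness : ∀ D → colourAt n x D ≡ combine (Labelling.colour n x) (Labelling.rawLabel n x mod d)
      by-emptiness (yes _) = refl
      by-emptiness (no x≡∅) = ⊥-elim (x≡∅ x≢∅)

    colour𝔛-empty : ∀ n (x : 𝔛ₙ n) → ¬ Nonempty (proj₁ x) →
                    colour𝔛 (n , x) ≡ emptyColour (Labelling.colour n x)
    colour𝔛-empty n x x≡∅ = by-emptiness (nonempty? (proj₁ x))
      where
      by-emptiness : ∀ D → colourAt n x D ≡ emptyColour (Labelling.colour n x)
      by-emptiness (yes x≢∅) = ⊥-elim (x≡∅ x≢∅)
      by-emptiness (no _) = refl

    colour𝔛-resp-nonempty : ∀ x y → x ≈ y → Nonempty (proj₁ (proj₂ x)) → colour𝔛 x ≡ colour𝔛 y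
    colour𝔛-resp-nonempty (n , A , p) (n′ , B , q) x≈y (pt , pt∈A) =
      same-level (to (x≈y (n , pt)) (refl , pt∈A))
      where
      same-level : (n′ , B , q) ∋ (n , pt) → colour𝔛 (n , A , p) ≡ colour𝔛 (n′ , B , q)
      same-level (refl , _) = same-subset (AtLevel.ι-≈⇒≡ n {A , p} {B , q} x≈y)
        where
        open Labelling n
        same-subset : A ≡ B → colour𝔛 (n , A , p) ≡ colour𝔛 (n , B , q)
        same-subset refl = begin
          colour𝔛 (n , A , p)                                ≡⟨ colour𝔛-nonempty n (A , p) (pt , pt∈A) ⟩
          combine (colour (A , p)) (rawLabel (A , p) mod d)  ≡⟨ cong₂ (λ c r → combine c (r mod d))
                                                                  (colour-resp A p q) (rawLabel-resp A p q) ⟩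
          combine (colour (A , q)) (rawLabel (A , q) mod d)  ≡⟨ colour𝔛-nonempty n (A , q) (pt , pt∈A) ⟨
          colour𝔛 (n , A , q)                                ∎
          where open ≡-Reasoning

    colour𝔛-resp : ∀ x y → x ≈ y → colour𝔛 x ≡ colour𝔛 y
    colour𝔛-resp x@(n , A , p) y@(n′ , B , q) x≈y = by-emptiness (nonempty? A) (nonempty? B)
      where
      by-emptiness : Dec (Nonempty A) → Dec (Nonempty B) → colour𝔛 x ≡ colour𝔛 y
      by-emptiness (yes A≢∅) _ = colour𝔛-resp-nonempty x y x≈y A≢∅
      by-emptiness (no _) (yes B≢∅) = sym (colour𝔛-resp-nonempty y x (≈-sym {x} {y} x≈y) B≢∅)
      by-emptiness (no A≡∅) (no B≡∅) = begin
        colour𝔛 x                              ≡⟨ colour𝔛-empty n (A , p) A≡∅ ⟩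
        emptyColour (Labelling.colour n (A , p))  ≡⟨ emptyColour-const _ (Labelling.colour n′ (B , q)) ⟩
        emptyColour (Labelling.colour n′ (B , q)) ≡⟨ colour𝔛-empty n′ (B , q) B≡∅ ⟨
        colour𝔛 y                              ∎
        where open ≡-Reasoning

    module MonochromaticEdge (n : ℕ) (𝒜 : Fin d → 𝔛) (cov : ∀ pt → Σ (Fin d) λ j → 𝒜 j ∋ (n , pt))
                             (mono : ∀ i j → colour𝔛 (𝒜 i) ≡ colour𝔛 (𝒜 j)) where

      open AtLevel n
      open Labelling n

      member : Fin d → Maybe (𝔛ₙ n)
      member j = atLevel (𝒜 j)

      covering : ∀ pt → ∃₂ λ j y → member j ≡ just y × pt ∈ proj₁ y
      covering pt = proj₁ (cov pt) , atLevel-∋ (𝒜 (proj₁ (cov pt))) (proj₂ (cov pt))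

      j₀ : Fin d
      j₀ = proj₁ (covering pt₀)

      y₀ : 𝔛ₙ n
      y₀ = proj₁ (proj₂ (covering pt₀))

      y₀-member : member j₀ ≡ just y₀
      y₀-member = proj₁ (proj₂ (proj₂ (covering pt₀)))

      pt₀∈y₀ : pt₀ ∈ proj₁ y₀
      pt₀∈y₀ = proj₂ (proj₂ (proj₂ (covering pt₀)))

      c : Fin m
      c = colour y₀

      member-colour : ∀ {j y pt} → member j ≡ just y → pt ∈ proj₁ y →
                      colour y ≡ c × rawLabel y mod d ≡ rawLabel y₀ mod d
      member-colour {j} {y} {pt} e pt∈y = Fin.combine-injective _ _ _ _ (begin
        combine (colour y) (rawLabel y mod d)    ≡⟨ colour𝔛-nonempty n y (pt , pt∈y) ⟨
        colour𝔛 (ι n y)                          ≡⟨ cong colour𝔛 (atLevel-sound (𝒜 j) e) ⟨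
        colour𝔛 (𝒜 j)                            ≡⟨ mono j j₀ ⟩
        colour𝔛 (𝒜 j₀)                           ≡⟨ cong colour𝔛 (atLevel-sound (𝒜 j₀) y₀-member) ⟩
        colour𝔛 (ι n y₀)                         ≡⟨ colour𝔛-nonempty n y₀ (pt₀ , pt₀∈y₀) ⟩
        combine (colour y₀) (rawLabel y₀ mod d)  ∎)
        where open ≡-Reasoning

      KindMember : Fin 3 → Set
      KindMember κ = ∃₂ λ j y → member j ≡ just y × kind (zone ∣ proj₁ y ∣) ≡ κ

      kindMember? : ∀ κ → Dec (KindMember κ)
      kindMember? κ = Fin.any? (of-kind? ∘ member)
        where
        of-kind? : ∀ x → Dec (∃ λ y → x ≡ just y × kind (zone ∣ proj₁ y ∣) ≡ κ)
        of-kind? nothing = no λ { (_ , () , _) }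
        of-kind? (just y) =
          Dec.map′ (λ h → y , refl , h) (λ { (_ , refl , h) → h }) (kind (zone ∣ proj₁ y ∣) Fin.≟ κ)

      layerOfKind : ∀ {κ} → Dec (KindMember κ) → List (Subset K)
      layerOfKind (yes (_ , (A , p) , _)) = Layer ∣ A ∣ p c
      layerOfKind (no _) = []

      layerOfKind-≡ : ∀ {κ} (D : Dec (KindMember κ)) → κ ≢ 0F → ∀ {j A p} → member j ≡ just (A , p) →
                      kind (zone ∣ A ∣) ≡ κ → layerOfKind D ≡ Layer ∣ A ∣ p c
      layerOfKind-≡ (yes (_ , (A′ , p′) , _ , A′∈κ)) κ≢0 {p = p} _ A∈κ =
        Layer-cong p′ p c (nonmid-unique p′ p (trans A′∈κ (sym A∈κ)) (κ≢0 ∘ trans (sym A′∈κ)))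
      layerOfKind-≡ (no ∄) _ e A∈κ = ⊥-elim (∄ (_ , _ , e , A∈κ))

      layerOfKind-inClass : ∀ {κ} (D : Dec (KindMember κ)) {B} → B ∈ˡ layerOfKind D → InClass c B
      layerOfKind-inClass (yes (_ , (A , p) , _)) = Layer-inClass p

      layerOfKind-kind : ∀ {κ} (D : Dec (KindMember κ)) {B} → B ∈ˡ layerOfKind D → kind (zone ∣ B ∣) ≡ κ
      layerOfKind-kind (yes (_ , (A , p) , _ , A∈κ)) B∈ = trans (cong (kind ∘ zone) (Layer-size p B∈)) A∈κ

      layerOfKind-unique : ∀ {κ} (D : Dec (KindMember κ)) → Unique (layerOfKind D)
      layerOfKind-unique (yes _) = colourClass-unique _ c
      layerOfKind-unique (no _) = []

      high? : Dec (KindMember 2F)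
      high? = kindMember? 2F

      low? : Dec (KindMember 1F)
      low? = kindMember? 1F

      High Low Pool : List (Subset K)
      High = layerOfKind high?
      Low = layerOfKind low?
      Pool = Mid c ++ High ++ Low

      pool-inClass : ∀ {B} → B ∈ˡ Pool → InClass c B
      pool-inClass B∈ = Sum.[ Mid-inClass , in-layers ∘ ∈-++⁻ High ]′ (∈-++⁻ (Mid c) B∈)
        where
        in-layers : ∀ {B} → B ∈ˡ High ⊎ B ∈ˡ Low → InClass c B
        in-layers = Sum.[ layerOfKind-inClass high? , layerOfKind-inClass low? ]′

      pool-unique : Unique Pool
      pool-unique = Unique.++⁺ (colourClass-unique _ c)
        (Unique.++⁺ (layerOfKind-unique high?) (layerOfKind-unique low?) High#Low) Mid#High++Low
        where
        different-kinds : ∀ B {κ κ′} → κ ≢ κ′ → kind (zone ∣ B ∣) ≡ κ → kind (zone ∣ B ∣) ≢ κ′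
        different-kinds B κ≢κ′ e e′ = κ≢κ′ (trans (sym e) e′)
        High#Low : Disjoint High Low
        High#Low {B} (B∈High , B∈Low) =
          different-kinds B (λ ()) (layerOfKind-kind high? B∈High) (layerOfKind-kind low? B∈Low)
        Mid#High++Low : Disjoint (Mid c) (High ++ Low)
        Mid#High++Low {B} (B∈Mid , B∈High++Low) =
          Sum.[ different-kinds B (λ ()) (Mid-mid B∈Mid) ∘ layerOfKind-kind high?
              , different-kinds B (λ ()) (Mid-mid B∈Mid) ∘ layerOfKind-kind low? ]′ (∈-++⁻ High B∈High++Low)

      member∈Layer : ∀ {A p} → colour (A , p) ≡ c → A ∈ˡ Layer ∣ A ∣ p c
      member∈Layer {A} {p} col = subst (λ c′ → A ∈ˡ Layer ∣ A ∣ p c′) col (∈-Layer p)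

      member∈pool : ∀ {j A p} → member j ≡ just (A , p) → colour (A , p) ≡ c → A ∈ˡ Pool
      member∈pool {j} {A} {p} mem col = by-zone (zone ∣ A ∣) refl
        where
        layer≡ : ∀ {κ} (D : Dec (KindMember κ)) → κ ≢ 0F → kind (zone ∣ A ∣) ≡ κ → A ∈ˡ layerOfKind D
        layer≡ D κ≢0 A∈κ = subst (A ∈ˡ_) (sym (layerOfKind-≡ D κ≢0 mem A∈κ)) (member∈Layer col)
        by-zone : ∀ z → zone ∣ A ∣ ≡ z → A ∈ˡ Pool
        by-zone (mid q)  e = ∈-++⁺ˡ (subst (λ c′ → A ∈ˡ Mid c′) col (∈-Mid p q e))
        by-zone (high _) e = ∈-++⁺ʳ (Mid c) (∈-++⁺ˡ (layer≡ high? (λ ()) (cong kind e)))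
        by-zone (low _)  e = ∈-++⁺ʳ (Mid c) (∈-++⁺ʳ High (layer≡ low? (λ ()) (cong kind e)))

      data Slot (A : Subset K) (r : ℕ) : Set where
        mid-slot  : A ∈ˡ Mid c → r ≡ position _≟ˢ_ A (Mid c) → Slot A r
        high-slot : A ∈ˡ High → r ≡ length (Mid c) + position _≟ˢ_ A High → Slot A r
        low-slot  : A ∈ˡ Low → r ≡ d ∸ suc (position _≟ˢ_ A Low) → Slot A r

      slot : ∀ {j A p} → member j ≡ just (A , p) → colour (A , p) ≡ c → Slot A (rawLabel (A , p))
      slot {j} {A} {p} mem col = by-zone (zone ∣ A ∣) refl
        where
        layer≡ : ∀ {κ} (D : Dec (KindMember κ)) → κ ≢ 0F → kind (zone ∣ A ∣) ≡ κ →
                 Layer ∣ A ∣ p (colour (A , p)) ≡ layerOfKind D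
        layer≡ D κ≢0 A∈κ = trans (cong (Layer ∣ A ∣ p) col) (sym (layerOfKind-≡ D κ≢0 mem A∈κ))
        by-zone : ∀ z → zone ∣ A ∣ ≡ z → Slot A (rawLabelᶻ A p z)
        by-zone (mid q)  e =
          mid-slot (subst (λ c′ → A ∈ˡ Mid c′) col (∈-Mid p q e)) (cong (λ c′ → position _≟ˢ_ A (Mid c′)) col)
        by-zone (high _) e = high-slot (subst (A ∈ˡ_) High≡ (∈-Layer p))
                               (cong₂ (λ c′ L → length (Mid c′) + position _≟ˢ_ A L) col High≡)
          where High≡ = layer≡ high? (λ ()) (cong kind e)
        by-zone (low _)  e = low-slot (subst (A ∈ˡ_) Low≡ (∈-Layer p))
                               (cong (λ L → d ∸ suc (position _≟ˢ_ A L)) Low≡)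
          where Low≡ = layer≡ low? (λ ()) (cong kind e)

      module SmallPool (small : length Pool < d) where

        #mid #high #low : ℕ
        #mid = length (Mid c)
        #high = length High
        #low = length Low

        #pool<d : #mid + #high + #low < d
        #pool<d = subst (_< d) length-Pool small
          where
          length-Pool : length Pool ≡ #mid + #high + #low
          length-Pool = trans (List.length-++ (Mid c))
                          (trans (cong (_+_ #mid) (List.length-++ High)) (sym (ℕ.+-assoc #mid #high #low)))

        mid-bound : ∀ {A r} → A ∈ˡ Mid c → r ≡ position _≟ˢ_ A (Mid c) → r < #mid
        mid-bound A∈ refl = position-< _≟ˢ_ A∈

        high-bound : ∀ {A r} → A ∈ˡ High → r ≡ #mid + position _≟ˢ_ A High → #mid ≤ r × r < #mid + #high
        high-bound A∈ refl = ℕ.m≤m+n #mid _ , ℕ.+-monoʳ-< #mid (position-< _≟ˢ_ A∈)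

        low-bound : ∀ {A r} → A ∈ˡ Low → r ≡ d ∸ suc (position _≟ˢ_ A Low) → #mid + #high < r × r < d
        low-bound A∈ refl =
          ℕ.m+n≤o⇒m≤o∸n (suc (#mid + #high))
            (ℕ.≤-trans (ℕ.+-monoʳ-≤ (suc (#mid + #high)) (position-< _≟ˢ_ A∈)) #pool<d) ,
          ∸-suc-< d≥1
          where
          ∸-suc-< : ∀ {e x} → 1 ≤ e → e ∸ suc x < e
          ∸-suc-< {suc e} {x} _ = s≤s (ℕ.m∸n≤m e x)

        slot-< : ∀ {A r} → Slot A r → r < d
        slot-< (mid-slot A∈ e) =
          ℕ.<-trans (mid-bound A∈ e) (ℕ.≤-<-trans (ℕ.≤-trans (ℕ.m≤m+n #mid #high) (ℕ.m≤m+n _ #low)) #pool<d)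
        slot-< (high-slot A∈ e) = ℕ.<-trans (proj₂ (high-bound A∈ e)) (ℕ.≤-<-trans (ℕ.m≤m+n _ #low) #pool<d)
        slot-< (low-slot A∈ e) = proj₂ (low-bound A∈ e)

        slot-injective : ∀ {A A′ r} → Slot A r → Slot A′ r → A ≡ A′
        slot-injective (mid-slot A∈ e) (mid-slot A′∈ e′) = position-injective _≟ˢ_ A∈ A′∈ (trans (sym e) e′)
        slot-injective (high-slot A∈ e) (high-slot A′∈ e′) =
          position-injective _≟ˢ_ A∈ A′∈ (ℕ.+-cancelˡ-≡ #mid _ _ (trans (sym e) e′))
        slot-injective (low-slot A∈ e) (low-slot A′∈ e′) =
          position-injective _≟ˢ_ A∈ A′∈ (ℕ.suc-injective (ℕ.∸-cancelˡ-≡ (≤d A∈) (≤d A′∈) (trans (sym e) e′)))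
          where
          ≤d : ∀ {B} → B ∈ˡ Low → suc (position _≟ˢ_ B Low) ≤ d
          ≤d B∈ = ℕ.≤-trans (position-< _≟ˢ_ B∈) (ℕ.≤-trans (ℕ.m≤n+m #low (#mid + #high)) (ℕ.<⇒≤ #pool<d))
        slot-injective (mid-slot A∈ e) (high-slot A′∈ e′) =
          ⊥-elim (ℕ.<⇒≱ (mid-bound A∈ e) (proj₁ (high-bound A′∈ e′)))
        slot-injective (high-slot A∈ e) (mid-slot A′∈ e′) =
          ⊥-elim (ℕ.<⇒≱ (mid-bound A′∈ e′) (proj₁ (high-bound A∈ e)))
        slot-injective (mid-slot A∈ e) (low-slot A′∈ e′) =
          ⊥-elim (ℕ.<-asym (mid-bound A∈ e) (ℕ.≤-<-trans (ℕ.m≤m+n #mid #high) (proj₁ (low-bound A′∈ e′))))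
        slot-injective (low-slot A∈ e) (mid-slot A′∈ e′) =
          ⊥-elim (ℕ.<-asym (mid-bound A′∈ e′) (ℕ.≤-<-trans (ℕ.m≤m+n #mid #high) (proj₁ (low-bound A∈ e))))
        slot-injective (high-slot A∈ e) (low-slot A′∈ e′) =
          ⊥-elim (ℕ.<-asym (proj₂ (high-bound A∈ e)) (proj₁ (low-bound A′∈ e′)))
        slot-injective (low-slot A∈ e) (high-slot A′∈ e′) =
          ⊥-elim (ℕ.<-asym (proj₂ (high-bound A′∈ e′)) (proj₁ (low-bound A∈ e)))

        impossible : ⊥
        impossible = inRange⇒¬full (proj₂ y₀) λ pt → in-y₀ (covering pt)
          where
          y₀-slot = slot y₀-member refl
          in-y₀ : ∀ {pt} → ∃₂ (λ j y → member j ≡ just y × pt ∈ proj₁ y) → pt ∈ proj₁ y₀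
          in-y₀ {pt} (j , (A , p) , mem , pt∈A) =
            subst (pt ∈_) (slot-injective A-slot (subst (Slot _) (sym same-label) y₀-slot)) pt∈A
            where
            A-slot = slot mem (proj₁ (member-colour mem pt∈A))
            same-label : rawLabel (A , p) ≡ rawLabel y₀
            same-label = mod-injective {d} (slot-< A-slot) (slot-< y₀-slot) (proj₂ (member-colour mem pt∈A))

      module LargePool (large : d ≤ length Pool) where

        memberSubset? : ∀ B → Dec (∃ λ j → Data.Maybe.map proj₁ (member j) ≡ just B)
        memberSubset? B = Fin.any? (λ j → Maybe.≡-dec _≟ˢ_ (Data.Maybe.map proj₁ (member j)) (just B))

        Members : List (Subset K)
        Members = filter memberSubset? Pool

        members-unique : Unique Members
        members-unique = Unique.filter⁺ memberSubset? pool-unique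

        padded = extend _≟ˢ_ d Members Pool members-unique pool-unique
                   (λ B∈ → proj₁ (∈-filter⁻ memberSubset? {xs = Pool} B∈))
                   (unique-image-length≤ (Data.Maybe.map proj₁ ∘ member) members-unique
                     (λ B∈ → proj₂ (∈-filter⁻ memberSubset? {xs = Pool} B∈)))
                   large

        f : Fin d → Subset K
        f = proj₁ padded

        f-pool : ∀ i → f i ∈ˡ Pool
        f-pool = proj₂ (proj₂ (proj₂ padded))

        g : Fin d → 𝔛ₙ n
        g i = f i , proj₁ (pool-inClass (f-pool i))

        g-distinct : Distinct _≈ₙ_ g
        g-distinct i j i≢j fi≡fj = i≢j (proj₁ (proj₂ padded) fi≡fj)

        g-covers : Covers (proj₁ ∘ g)
        g-covers pt = in-g (covering pt)
          where
          in-g : ∃₂ (λ j y → member j ≡ just y × pt ∈ proj₁ y) → ∃ λ i → pt ∈ f i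
          in-g (j , (A , p) , mem , pt∈A) =
            let A∈Members = ∈-filter⁺ memberSubset? (member∈pool mem (proj₁ (member-colour mem pt∈A)))
                                       (j , cong (Data.Maybe.map proj₁) mem)
                (i , fi≡A) = proj₁ (proj₂ (proj₂ padded)) A∈Members
            in i , subst (pt ∈_) (sym fi≡A) pt∈A

        impossible : ⊥
        impossible = colour-proper g g-distinct (covers⇒color0 g g-covers)
                       (λ i j → trans (proj₂ (pool-inClass (f-pool i))) (sym (proj₂ (pool-inClass (f-pool j)))))

      impossible : ⊥
      impossible = by-size (d ℕ.≤? length Pool)
        where
        by-size : Dec (d ≤ length Pool) → ⊥
        by-size (yes large) = LargePool.impossible large
        by-size (no ¬large) = SmallPool.impossible (ℕ.≰⇒> ¬large)

    colour𝔛-proper : ∀ 𝒜 → Distinct _≈_ 𝒜 → Color0 𝒜 → ¬ (∀ i j → colour𝔛 (𝒜 i) ≡ colour𝔛 (𝒜 j))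
    colour𝔛-proper 𝒜 _ (n , cov) mono = MonochromaticEdge.impossible n 𝒜 cov mono

    χ≤m*d : χ≤ (m * d)
    χ≤m*d = colour𝔛 , colour𝔛-resp , colour𝔛-proper

  -- Bounded colourings from a trivial ideal

  module FromTrivialIdeal (Fs : List 𝔛) (r : ℕ) (Hs : Fin r → 𝔛 → Set) (hom : ∀ i → Homogeneous (Hs i))
                          (cov : ∀ x → ⊤ → Any (x ≈_) Fs ⊎ Σ (Fin r) λ i → Hs i x) where

    t : ℕ
    t = proj₁ (<1⇒uniform-gap {β} β<1)

    -- A 0-homogeneous Hs i meets each 𝔛ₙ in fewer than N₀ sets (slice-small).
    N₀ M₁ : ℕ
    N₀ = suc (t * ℕ.pred d)
    M₁ = suc (length Fs + r * N₀)

    module CoverColouring (n : ℕ) (V : Subset (k n) → Set) (V? : Decidable V)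
                          (prov : ∀ {B} → V B → InRange n B) where

      open AtLevel n

      point : ∀ {B} → V B → 𝔛
      point {B} v = ι n (B , prov v)

      Piece : Set
      Piece = Fin (length Fs) ⊎ Fin r

      pieceᶜ : ∀ {x} → Any (x ≈_) Fs ⊎ Σ (Fin r) (λ i → Hs i x) → Piece
      pieceᶜ (inj₁ x∈Fs) = inj₁ (index x∈Fs)
      pieceᶜ (inj₂ (i , _)) = inj₂ i

      piece : ∀ {B} → V B → Piece
      piece v = pieceᶜ (cov (point v) tt)

      piece-Fs : ∀ {B} (v : V B) {e} → piece v ≡ inj₁ e → point v ≈ lookup Fs e
      piece-Fs v = sound (cov (point v) tt)
        where
        sound : ∀ {x e} (C : Any (x ≈_) Fs ⊎ Σ (Fin r) (λ i → Hs i x)) → pieceᶜ C ≡ inj₁ e → x ≈ lookup Fs e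
        sound (inj₁ x∈Fs) refl = lookup-index x∈Fs

      piece-Hs : ∀ {B} (v : V B) {i} → piece v ≡ inj₂ i → Hs i (point v)
      piece-Hs v = sound (cov (point v) tt)
        where
        sound : ∀ {x i} (C : Any (x ≈_) Fs ⊎ Σ (Fin r) (λ i → Hs i x)) → pieceᶜ C ≡ inj₂ i → Hs i x
        sound (inj₂ (i , x∈Hsᵢ)) refl = x∈Hsᵢ

      pieceᵈ : ∀ B → Dec (V B) → Maybe Piece
      pieceᵈ B (yes v) = just (piece v)
      pieceᵈ B (no _) = nothing

      pieceOf : Subset K → Maybe Piece
      pieceOf B = pieceᵈ B (V? B)

      pieceOf-sound : ∀ {B x} → pieceOf B ≡ just x → Σ (V B) λ v → piece v ≡ x
      pieceOf-sound {B} = sound (V? B)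
        where
        sound : ∀ {x} D → pieceᵈ B D ≡ just x → Σ (V B) λ v → piece v ≡ x
        sound (yes v) refl = v , refl

      pieceOf-V : ∀ {B} → V B → Σ (V B) λ v → pieceOf B ≡ just (piece v)
      pieceOf-V {B} v = complete (V? B)
        where
        complete : ∀ D → Σ (V B) λ v → pieceᵈ B D ≡ just (piece v)
        complete (yes v′) = v′ , refl
        complete (no ¬v) = ⊥-elim (¬v v)

      inSlice? : ∀ i → Decidable (λ B → pieceOf B ≡ just (inj₂ i))
      inSlice? i B = Maybe.≡-dec (Sum.≡-dec Fin._≟_ Fin._≟_) (pieceOf B) (just (inj₂ i))

      Slice : Fin r → List (Subset K)
      Slice i = filter (inSlice? i) (subsets K)

      Slice-piece : ∀ {i B} → B ∈ˡ Slice i → Σ (V B) λ v → piece v ≡ inj₂ i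
      Slice-piece {i} B∈ = pieceOf-sound (proj₂ (∈-filter⁻ (inSlice? i) {xs = subsets K} B∈))

      ∈-Slice : ∀ {i B} → pieceOf B ≡ just (inj₂ i) → B ∈ˡ Slice i
      ∈-Slice {i} {B} = ∈-filter⁺ (inSlice? i) (∈-subsets B)

      slice-small : ∀ i → (∀ 𝒜 → Distinct _≈_ 𝒜 → (∀ j → Hs i (𝒜 j)) → Color0 𝒜) → length (Slice i) < N₀
      slice-small i zero-hom = s≤s (double-counting ∁ t (ℕ.pred d) (Slice i) large-complement sparse)
        where
        large-complement : ∀ {B} → B ∈ˡ Slice i → K ≤ t * ∣ ∁ B ∣
        large-complement {B} B∈ = subst (λ x → K ≤ t * x) (sym (∣∁p∣≡n∸∣p∣ B))
          (proj₂ (<1⇒uniform-gap {β} β<1) K ∣ B ∣ (proj₂ (prov (proj₁ (Slice-piece B∈)))))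
        missed-by-d : ∀ pt → d ≤ count ∁ pt (Slice i) → ⊥
        missed-by-d pt d≤count = x∈∁p⇒x∉p (missing j) pt∈
          where
          Missing = filter (λ B → pt ∈? ∁ B) (Slice i)
          chosen = extend _≟ˢ_ d [] Missing []
                     (Unique.filter⁺ _ (Unique.filter⁺ _ (subsets-unique K))) (λ ()) z≤n d≤count
          f = proj₁ chosen
          f∈Missing⁻ : ∀ j → f j ∈ˡ Slice i × pt ∈ ∁ (f j)
          f∈Missing⁻ j = ∈-filter⁻ (λ B → pt ∈? ∁ B) {xs = Slice i} (proj₂ (proj₂ (proj₂ chosen)) j)
          missing : ∀ j → pt ∈ ∁ (f j)
          missing j = proj₂ (f∈Missing⁻ j)
          v : ∀ j → V (f j)
          v j = proj₁ (Slice-piece (proj₁ (f∈Missing⁻ j)))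
          g : Fin d → 𝔛ₙ n
          g j = f j , prov (v j)
          distinct : Distinct _≈_ (ι n ∘ g)
          distinct i j i≢j e = i≢j (proj₁ (proj₂ chosen) (ι-≈⇒≡ {g i} {g j} e))
          in-Hsᵢ : ∀ j → Hs i (ι n (g j))
          in-Hsᵢ j = piece-Hs (v j) (proj₂ (Slice-piece (proj₁ (f∈Missing⁻ j))))
          covering = color0⇒covers g (zero-hom (ι n ∘ g) distinct in-Hsᵢ) pt
          j = proj₁ covering
          pt∈ = proj₂ covering
        sparse : ∀ pt → count ∁ pt (Slice i) ≤ ℕ.pred d
        sparse pt = ℕ.≮⇒≥ λ pred-d<count →
          missed-by-d pt (subst (_≤ count ∁ pt (Slice i)) (ℕ.suc-pred d) pred-d<count)

      offset : ∀ i → Homogeneous (Hs i) → Subset K → Fin N₀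
      offset i (inj₁ _) B = position _≟ˢ_ B (Slice i) mod N₀
      offset i (inj₂ _) B = zero

      Payload : Set
      Payload = Fin (length Fs) ⊎ (Fin r × Fin N₀)

      payloadᵖ : Subset K → Maybe Piece → Maybe Payload
      payloadᵖ B nothing = nothing
      payloadᵖ B (just (inj₁ e)) = just (inj₁ e)
      payloadᵖ B (just (inj₂ i)) = just (inj₂ (i , offset i (hom i) B))

      colouring : Subset K → Fin M₁
      colouring B = encode (length Fs) r N₀ (payloadᵖ B (pieceOf B))

      payload-Fs : ∀ B x {e} → payloadᵖ B (just x) ≡ just (inj₁ e) → x ≡ inj₁ e
      payload-Fs B (inj₁ _) refl = refl

      payload-Hs : ∀ B x {i o} → payloadᵖ B (just x) ≡ just (inj₂ (i , o)) → x ≡ inj₂ i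
      payload-Hs B (inj₂ _) refl = refl

      offsetOf : Maybe Payload → Fin N₀
      offsetOf (just (inj₂ (_ , o))) = o
      offsetOf _ = zero

      colouring-proper : ProperOn V colouring
      colouring-proper A (inV , distinct , covers , mono) = by-piece (piece (v j₀)) refl
        where
        j₀ : Fin d
        j₀ = fromℕ< d≥1
        v : ∀ j → V (A j)
        v j = proj₁ (pieceOf-V (inV j))
        pieceOf≡ : ∀ j → pieceOf (A j) ≡ just (piece (v j))
        pieceOf≡ j = proj₂ (pieceOf-V (inV j))
        payload≡ : ∀ j → payloadᵖ (A j) (just (piece (v j))) ≡ payloadᵖ (A j₀) (just (piece (v j₀)))
        payload≡ j = trans (cong (payloadᵖ (A j)) (sym (pieceOf≡ j)))
                       (trans (encode-injective _ _ _ (mono j j₀)) (cong (payloadᵖ (A j₀)) (pieceOf≡ j₀)))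
        all-equal : ¬ (∀ j → A j ≡ A j₀)
        all-equal = single-cover-impossible (prov (v j₀)) covers
        g : Fin d → 𝔛ₙ n
        g j = A j , prov (v j)
        by-piece : ∀ x → piece (v j₀) ≡ x → ⊥
        by-piece (inj₁ e) e₀ = all-equal λ j → ι-≈⇒≡ {g j} {g j₀}
          (≈-trans {ι n (g j)} {lookup Fs e} {ι n (g j₀)}
            (piece-Fs (v j) (Fs-piece j)) (≈-sym {ι n (g j₀)} {lookup Fs e} (piece-Fs (v j₀) e₀)))
          where
          Fs-piece : ∀ j → piece (v j) ≡ inj₁ e
          Fs-piece j = payload-Fs (A j) _ (trans (payload≡ j) (cong (payloadᵖ (A j₀) ∘ just) e₀))
        by-piece (inj₂ i) e₀ = by-hom (hom i) (λ j → cong offsetOf (payload≡′ j))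
          where
          Hs-piece : ∀ j → piece (v j) ≡ inj₂ i
          Hs-piece j = payload-Hs (A j) _ (trans (payload≡ j) (cong (payloadᵖ (A j₀) ∘ just) e₀))
          payload≡′ : ∀ j → payloadᵖ (A j) (just (inj₂ i)) ≡ payloadᵖ (A j₀) (just (inj₂ i))
          payload≡′ j = trans (cong (payloadᵖ (A j) ∘ just) (sym (Hs-piece j)))
                          (trans (payload≡ j) (cong (payloadᵖ (A j₀) ∘ just) e₀))
          in-slice : ∀ j → A j ∈ˡ Slice i
          in-slice j = ∈-Slice (trans (pieceOf≡ j) (cong just (Hs-piece j)))
          by-hom : (h : Homogeneous (Hs i)) → (∀ j → offset i h (A j) ≡ offset i h (A j₀)) → ⊥
          by-hom (inj₂ one-hom) _ = one-hom (ι n ∘ g) (λ i j i≢j e → distinct i j i≢j (ι-≈⇒≡ {g i} {g j} e))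
                                      (λ j → piece-Hs (v j) (Hs-piece j)) (covers⇒color0 g covers)
          by-hom (inj₁ zero-hom) same-offset = all-equal λ j →
            position-injective _≟ˢ_ (in-slice j) (in-slice j₀)
              (mod-injective {N₀} (<N₀ j) (<N₀ j₀) (same-offset j))
            where
            <N₀ : ∀ j → position _≟ˢ_ (A j) (Slice i) < N₀
            <N₀ j = ℕ.<-trans (position-< _≟ˢ_ (in-slice j)) (slice-small i zero-hom)

    module LevelColouring (n : ℕ) where

      open AtLevel n

      IsMid : Subset K → Set
      IsMid B = kind (zone ∣ B ∣) ≡ 0F

      isMid? : Decidable IsMid
      isMid? B = kind (zone ∣ B ∣) Fin.≟ 0F

      OfSize : ℕ → Subset K → Set
      OfSize a B = ∣ B ∣ ≡ a

      midProper : ∃ (ProperOn IsMid)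
      midProper = colouring , colouring-proper
        where open CoverColouring n IsMid isMid? (λ {B} → mid-inRange (zone ∣ B ∣))

      sizeProper : ∀ a → InR a → ∃ (ProperOn (OfSize a))
      sizeProper a p = colouring , colouring-proper
        where open CoverColouring n (OfSize a) (λ B → ∣ B ∣ ℕ.≟ a) (λ e → subst InR (sym e) p)

      midColouring : Subset K → Fin M₁
      midColouring = lookupᵀ (proj₁ (canonical isMid? midProper))

      layerColouring : ∀ a → .(InR a) → Subset K → Fin M₁
      layerColouring a p = lookupᵀ (proj₁ (canonical (λ B → ∣ B ∣ ℕ.≟ a) (sizeProper a p)))

      layerColouring-cong : ∀ {a b} .p .q B → a ≡ b → layerColouring a p B ≡ layerColouring b q B
      layerColouring-cong p q B refl = refl

      zoneColour : (A : Subset K) → .(InR ∣ A ∣) → Zone ∣ A ∣ → Fin M₁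
      zoneColour A p (mid _)  = midColouring A
      zoneColour A p (low _)  = layerColouring ∣ A ∣ p A
      zoneColour A p (high _) = layerColouring ∣ A ∣ p A

      zoneColour-mid : ∀ {A} .p (z : Zone ∣ A ∣) → kind z ≡ 0F → zoneColour A p z ≡ midColouring A
      zoneColour-mid p (mid _) _ = refl

      zoneColour-layer : ∀ {A} .p (z : Zone ∣ A ∣) → kind z ≢ 0F → zoneColour A p z ≡ layerColouring ∣ A ∣ p A
      zoneColour-layer p (mid _)  nonmid = ⊥-elim (nonmid refl)
      zoneColour-layer p (low _)  _ = refl
      zoneColour-layer p (high _) _ = refl

      levelColour : 𝔛ₙ n → Fin (3 * M₁)
      levelColour (A , p) = combine (kind (zone ∣ A ∣)) (zoneColour A p (zone ∣ A ∣))

      levelColour-resp : ∀ x y → x ≈ₙ y → levelColour x ≡ levelColour y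
      levelColour-resp _ _ refl = refl

      levelColour-proper : ∀ (g : Fin d → 𝔛ₙ n) → Distinct _≈ₙ_ g → Color0 (ι n ∘ g) →
                           ¬ (∀ i j → levelColour (g i) ≡ levelColour (g j))
      levelColour-proper g distinct color0 mono = by-kind (kind (zone ∣ A j₀ ∣) Fin.≟ 0F)
        where
        A : Fin d → Subset K
        A = proj₁ ∘ g
        j₀ : Fin d
        j₀ = fromℕ< d≥1
        zc : Fin d → Fin M₁
        zc j = zoneColour (A j) (proj₂ (g j)) (zone ∣ A j ∣)
        split : ∀ i j → kind (zone ∣ A i ∣) ≡ kind (zone ∣ A j ∣) × zc i ≡ zc j
        split i j = Fin.combine-injective (kind (zone ∣ A i ∣)) (zc i) (kind (zone ∣ A j ∣)) (zc j) (mono i j)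
        same-kind : ∀ j → kind (zone ∣ A j ∣) ≡ kind (zone ∣ A j₀ ∣)
        same-kind j = proj₁ (split j j₀)
        covers = color0⇒covers g color0
        by-kind : Dec (kind (zone ∣ A j₀ ∣) ≡ 0F) → ⊥
        by-kind (yes mid₀) = proj₂ (canonical isMid? midProper) A (all-mid , distinct , covers , λ i j →
          trans (sym (as-mid i)) (trans (proj₂ (split i j)) (as-mid j)))
          where
          all-mid : ∀ j → IsMid (A j)
          all-mid j = trans (same-kind j) mid₀
          as-mid : ∀ j → zc j ≡ midColouring (A j)
          as-mid j = zoneColour-mid (proj₂ (g j)) _ (all-mid j)
        by-kind (no nonmid₀) = proj₂ (canonical (λ B → ∣ B ∣ ℕ.≟ a₀) (sizeProper a₀ (proj₂ (g j₀)))) A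
          (same-size , distinct , covers , λ i j →
            trans (sym (as-layer i)) (trans (proj₂ (split i j)) (as-layer j)))
          where
          a₀ = ∣ A j₀ ∣
          nonmid : ∀ j → kind (zone ∣ A j ∣) ≢ 0F
          nonmid j = nonmid₀ ∘ trans (sym (same-kind j))
          same-size : ∀ j → ∣ A j ∣ ≡ a₀
          same-size j = nonmid-unique (proj₂ (g j)) (proj₂ (g j₀)) (same-kind j) (nonmid j)
          as-layer : ∀ j → zc j ≡ layerColouring a₀ (proj₂ (g j₀)) (A j)
          as-layer j = trans (zoneColour-layer (proj₂ (g j)) _ (nonmid j))
                         (layerColouring-cong (proj₂ (g j)) (proj₂ (g j₀)) (A j) (same-size j))

      χₙ≤3M₁ : χₙ≤ n (3 * M₁)
      χₙ≤3M₁ = levelColour , levelColour-resp , levelColour-proper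

  trivial⇒bounded : InIdeal (λ _ → ⊤) → Σ ℕ supχₙ≤
  trivial⇒bounded (Fs , r , Hs , hom , cov) = _ , FromTrivialIdeal.LevelColouring.χₙ≤3M₁ Fs r Hs hom cov

proposition5p12 :
    (k : ℕ → ℕ) (α β : ℝ) (d : ℕ) →
    (∀ n → 1 ≤ k n) →
    (∀ N → Σ ℕ λ n → N ≤ k n) →
    0≤ʳ α → α ≤ʳ β → β <1 →
    1 ≤ d →
    let open Setting k α β d in
      -- sup_n χ(ℋ₀(𝒸ₙ)) ≤ χ(ℋ₀(𝒸))
      (∀ n m → χ≤ m → χₙ≤ n m)
      -- χ(ℋ₀(𝒸)) ≤ sup_n χ(ℋ₀(𝒸ₙ)) · d
      × (∀ m → supχₙ≤ m → χ≤ (m * d))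
      -- ⟨hom(𝒸)⟩ non-trivial ⇔ sup_n χ(ℋ₀(𝒸ₙ)) = ∞
      × (NonTrivialIdeal ⇔ (¬ Σ ℕ λ m → supχₙ≤ m))
proposition5p12 k α β d k≥1 _ _ _ β<1 d≥1 =
  χ≤⇒χₙ≤ ,
  FromLevelColourings.χ≤m*d ,
  mk⇔ (λ nontrivial (m , bounded) → nontrivial (χ≤⇒trivial (FromLevelColourings.χ≤m*d m bounded)))
      (λ unbounded trivial → unbounded (trivial⇒bounded trivial))
  where open Colourings k α β d k≥1 β<1 d≥1
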